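{- For all integers $k\geq 0$ and $r\geq 0$, $$\mathrm{Valley}_k^r(x)=\delta_{r,0}R_{k+1}(x)+\frac{x^{r}C^{r+1}(x)}{U_{k+1}^2\left(\frac{1}{2\sqrt{x}}\right)\Big(1-x\big(R_{k+1}(x)-1\big)C(x)\Big)^{r+1}}.$$
   Context: A Dyck path is a lattice path in $\mathbb{Z}\times\mathbb{Z}$ consisting of up-steps $(1,1)$ and down-steps $(1,-1)$ that never passes below the $x$-axis. A valley at height $k$ is a point of the path with $y$-coordinate $k$ that is immediately preceded by a down-step and immediately followed by an up-step. Let $\mathrm{valley}_k^r(n)$ be the number of Dyck paths from $(0,0)$ to $(2n,0)$ with exactly $r$ valleys at height $k$, and $\mathrm{Valley}_k^r(x)=\sum_{n\geq0}\mathrm{valley}_k^r(n)x^n$ (the empty path counts for $n=0$). $C(x)=\frac{1-\sqrt{1-4x}}{2x}$ is the Catalan generating function. $U_r$ is the Chebyshev polynomial of the second kind, $U_r(\cos\theta)=\frac{\sin((r+1)\theta)}{\sin\theta}$ for $r\geq 0$, with $U_{ -1}=0$. For $k\geq0$, $R_k(x)=\frac{U_{k-1}\left(\frac{1}{2\sqrt{x}}\right)}{\sqrt{x}\,U_k\left(\frac{1}{2\sqrt{x}}\right)}$, a rational function of $x$ (e.g. $R_0=0$, $R_1=1$, $R_2=1/(1-x)$); likewise $U_{k+1}^2\left(\frac{1}{2\sqrt{x}}\right)$ is a rational function of $x$. $\delta_{r,0}$ is the Kronecker delta. -}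

module Defs where

open import Data.Bool using (Bool; true; false; if_then_else_; _∧_)
open import Data.Nat as ℕ using (ℕ; zero; suc; _≡ᵇ_)
open import Data.Nat.Combinatorics using (_C_)
open import Data.Nat.DivMod using (_/_)
open import Data.Integer as ℤ using (ℤ; +_)
open import Data.List using (List; []; _∷_; _++_; map; length)
open import Relation.Binary.PropositionalEquality using (_≡_)

data Step : Set where
  U D : Step

words : ℕ → List (List Step)
words zero    = [] ∷ []
words (suc m) = map (U ∷_) (words m) ++ map (D ∷_) (words m)

-- starting at height h, the path never goes below 0 and ends at height 0
dyckFrom : ℕ → List Step → Bool
dyckFrom zero    []      = true
dyckFrom (suc h) []      = false
dyckFrom h       (U ∷ s) = dyckFrom (suc h) s
dyckFrom zero    (D ∷ s) = false
dyckFrom (suc h) (D ∷ s) = dyckFrom h s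

isDyck : List Step → Bool
isDyck = dyckFrom 0

-- number of valleys at height k of a path started at height h
-- (a valley: a down-step immediately followed by an up-step; its height
--  is the height of the point between them)
valleysFrom : ℕ → ℕ → List Step → ℕ
valleysFrom k h       []            = 0
valleysFrom k h       (U ∷ s)       = valleysFrom k (suc h) s
valleysFrom k zero    (D ∷ s)       = valleysFrom k zero s
valleysFrom k (suc h) (D ∷ [])      = 0
valleysFrom k (suc h) (D ∷ D ∷ s)   = valleysFrom k h (D ∷ s)
valleysFrom k (suc h) (D ∷ U ∷ s)   =
  (if h ≡ᵇ k then 1 else 0) ℕ.+ valleysFrom k h (U ∷ s)

valleys : ℕ → List Step → ℕ
valleys k = valleysFrom k 0

countTrue : {A : Set} → (A → Bool) → List A → ℕ
countTrue p []       = 0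
countTrue p (x ∷ xs) = (if p x then 1 else 0) ℕ.+ countTrue p xs

valley : ℕ → ℕ → ℕ → ℕ
valley k r n =
  countTrue (λ w → isDyck w ∧ (valleys k w ≡ᵇ r)) (words (2 ℕ.* n))

Series : Set
Series = ℕ → ℤ

sumUpTo : ℕ → (ℕ → ℤ) → ℤ
sumUpTo zero    f = f 0
sumUpTo (suc n) f = sumUpTo n f ℤ.+ f (suc n)

const : ℤ → Series
const c zero    = c
const c (suc n) = + 0

𝟘 𝟙 X : Series
𝟘 = const (+ 0)
𝟙 = const (+ 1)
X zero          = + 0
X (suc zero)    = + 1
X (suc (suc n)) = + 0

infixl 6 _⊕_ _⊖_
infixl 7 _⊛_
infixr 8 _^^_

_⊕_ _⊖_ _⊛_ : Series → Series → Series
(f ⊕ g) n = f n ℤ.+ g n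
(f ⊖ g) n = f n ℤ.- g n
(f ⊛ g) n = sumUpTo n (λ i → f i ℤ.* g (n ℕ.∸ i))

_^^_ : Series → ℕ → Series
f ^^ zero  = 𝟙
f ^^ suc m = f ⊛ (f ^^ m)

-- multiplicative inverse of a series with constant term 1:
-- 1/f = 1/(1 - (1 - f)) = Σ_j (1 - f)^j, and for coefficient n only j ≤ n
-- contribute (since 1 - f has zero constant term).
inv : Series → Series
inv f n = sumUpTo n (λ j → ((𝟙 ⊖ f) ^^ j) n)

-- Catalan generating function C(x) = (1 - √(1-4x))/(2x) = Σ Cat_n x^n

catalan : ℕ → ℕ
catalan n = ((2 ℕ.* n) C n) / suc n

Cat : Series
Cat n = + catalan n

-- Chebyshev polynomials evaluated at 1/(2√x), homogenised:
-- UU k = (√x)^k · U_k(1/(2√x)), a polynomial in x.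
-- From U_{k+1}(t) = 2t U_k(t) - U_{k-1}(t), U_0 = 1, U_{-1} = 0:
-- UU 0 = 1, UU 1 = 1, UU (k+2) = UU (k+1) - x · UU k.

UU : ℕ → Series
UU zero          = 𝟙
UU (suc zero)    = 𝟙
UU (suc (suc k)) = UU (suc k) ⊖ X ⊛ UU k

-- R_k(x) = U_{k-1}(1/(2√x)) / (√x U_k(1/(2√x))) = UU (k-1) / UU k
R : ℕ → Series
R zero    = 𝟘
R (suc k) = UU k ⊛ inv (UU (suc k))

-- 1 / U_{k}^2(1/(2√x)) = x^k / UU(k)^2
invUsq : ℕ → Series
invUsq k = X ^^ k ⊛ inv (UU k ⊛ UU k)

δ : ℕ → ℕ → Series
δ r s = if r ≡ᵇ s then 𝟙 else 𝟘

Valley : ℕ → ℕ → Series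
Valley k r n = + valley k r n

_≋_ : Series → Series → Set
f ≋ g = ∀ n → f n ≡ g n

{-# OPTIONS --safe #-}
-- Split a nonempty Dyck path at its first return to the axis, w = U a D b. The valleys of w
-- at height k + 1 are those of a at height k and those of b at height k + 1; its valleys at
-- height 0 are those of b, plus one at the junction when b is nonempty. So, with y marking
-- valleys, W_k = Σ valley_k^r(n) yʳ xⁿ satisfies
--   W_{k+1} = 1 + x W_k W_{k+1}   and   W_0 = 1 + x C (1 + y (W_0 - 1)),
-- where C counts Dyck paths by the Catalan numbers (reflection principle). Each equation
-- determines W_k, so it suffices that the closed form
--   R_{k+1} + (C / U_{k+1}²) · 1 / (D_k - y x C),   D_k = 1 - x (R_{k+1} - 1) C,
-- satisfies them. For k = 0 the equation is linear in W_0; the induction step follows from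
-- R_{k+2} (1 - x R_{k+1}) = 1, 1/U_{k+2}² = x R_{k+2}² / U_{k+1}² and
-- D_{k+1} = D_k - x R_{k+2} C / U_{k+1}², consequences of the Chebyshev recurrence and
-- Cassini's identity. Finally the coefficient of yʳ in 1 / (D_k - y x C) is (x C)ʳ / D_k^{r+1}.
module Submission where

open import Algebra.Bundles using (CommutativeRing)
import Data.Integer.Properties

module IntegerCoefficientSolver {r₁ r₂} (R : CommutativeRing r₁ r₂) where

  open CommutativeRing R
  open import Algebra.Properties.Semiring.Mult.TCOptimised semiring
    using (_×_; ×-homo-+; ×1-homo-*; 1+×)
  import Algebra.Properties.AbelianGroup as AbelianGroupProperties
  import Algebra.Properties.CommutativeSemigroup as CommutativeSemigroupProperties
  import Algebra.Properties.Ring as RingProperties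
  import Algebra.Properties.Group as GroupProperties
  open import Algebra.Solver.Ring.AlmostCommutativeRing
    using (fromCommutativeRing; _-Raw-AlmostCommutative⟶_)
  open import Data.Nat as ℕ using (ℕ; suc)
  open import Data.Integer as ℤ using (ℤ; +_; -[1+_]; _⊖_)
  import Data.Integer.Properties as ℤ
  open import Data.Integer.Solver using (module +-*-Solver)
  open import Data.Maybe using (Maybe; just; nothing)
  open import Relation.Nullary using (yes; no)
  open import Relation.Binary.PropositionalEquality as ≡ using (_≡_)
  open import Relation.Binary.Reasoning.Setoid setoid

  private
    open AbelianGroupProperties +-abelianGroup using (⁻¹-anti-homo‿-; ⁻¹-∙-comm)
    open CommutativeSemigroupProperties +-commutativeSemigroup using (interchange)
    open RingProperties ring using (x[y-z]≈xy-xz; [y-z]x≈yx-zx)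
    open GroupProperties +-group using (ε⁻¹≈ε)

    fromℕ : ℕ → Carrier
    fromℕ n = n × 1#

    fromℤ : ℤ → Carrier
    fromℤ (+ n)    = fromℕ n
    fromℤ -[1+ n ] = - fromℕ (suc n)

    [x+y]-[u+v]≈[x-u]+[y-v] : ∀ x y u v → (x + y) - (u + v) ≈ (x - u) + (y - v)
    [x+y]-[u+v]≈[x-u]+[y-v] x y u v = begin
      (x + y) + - (u + v)   ≈⟨ +-congˡ (⁻¹-∙-comm u v) ⟨
      (x + y) + (- u + - v) ≈⟨ interchange x y (- u) (- v) ⟩
      (x - u) + (y - v)     ∎

    [x-y][u-v]≈[xu+yv]-[xv+yu] : ∀ x y u v →
      (x - y) * (u - v) ≈ (x * u + y * v) - (x * v + y * u)
    [x-y][u-v]≈[xu+yv]-[xv+yu] x y u v = begin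
      (x - y) * (u - v)                   ≈⟨ [y-z]x≈yx-zx (u - v) x y ⟩
      x * (u - v) - y * (u - v)           ≈⟨ +-cong (x[y-z]≈xy-xz x u v) (-‿cong (x[y-z]≈xy-xz y u v)) ⟩
      (x * u - x * v) + - (y * u - y * v) ≈⟨ +-congˡ (⁻¹-anti-homo‿- (y * u) (y * v)) ⟩
      (x * u - x * v) + (y * v - y * u)   ≈⟨ interchange (x * u) (- (x * v)) (y * v) (- (y * u)) ⟩
      (x * u + y * v) + (- (x * v) + - (y * u)) ≈⟨ +-congˡ (⁻¹-∙-comm (x * v) (y * u)) ⟩
      (x * u + y * v) - (x * v + y * u)   ∎

    fromℤ-⊖ : ∀ m n → fromℤ (m ⊖ n) ≈ fromℕ m - fromℕ n
    fromℤ-⊖ m       ℕ.zero  = sym (trans (+-congˡ ε⁻¹≈ε) (+-identityʳ _))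
    fromℤ-⊖ ℕ.zero  (suc n) = sym (+-identityˡ _)
    fromℤ-⊖ (suc m) (suc n) = begin
      fromℤ (suc m ⊖ suc n)               ≡⟨ ≡.cong fromℤ (ℤ.[1+m]⊖[1+n]≡m⊖n m n) ⟩
      fromℤ (m ⊖ n)                       ≈⟨ fromℤ-⊖ m n ⟩
      fromℕ m - fromℕ n                   ≈⟨ +-identityˡ _ ⟨
      0# + (fromℕ m - fromℕ n)            ≈⟨ +-congʳ (-‿inverseʳ 1#) ⟨
      (1# - 1#) + (fromℕ m - fromℕ n)     ≈⟨ [x+y]-[u+v]≈[x-u]+[y-v] 1# (fromℕ m) 1# (fromℕ n) ⟨
      (1# + fromℕ m) - (1# + fromℕ n)     ≈⟨ +-cong (1+× m 1#) (-‿cong (1+× n 1#)) ⟨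
      fromℕ (suc m) - fromℕ (suc n)       ∎

    positivePart negativePart : ℤ → ℕ
    positivePart (+ n)    = n
    positivePart -[1+ n ] = 0
    negativePart (+ n)    = 0
    negativePart -[1+ n ] = suc n

    ≡positivePart⊖negativePart : ∀ i → i ≡ positivePart i ⊖ negativePart i
    ≡positivePart⊖negativePart (+ n)    = ≡.refl
    ≡positivePart⊖negativePart -[1+ n ] = ≡.refl

    fromℤ-parts : ∀ i → fromℤ i ≈ fromℕ (positivePart i) - fromℕ (negativePart i)
    fromℤ-parts i = trans (reflexive (≡.cong fromℤ (≡positivePart⊖negativePart i)))
                          (fromℤ-⊖ (positivePart i) (negativePart i))

    open +-*-Solver using (solve; _:=_; _:+_; _:*_; _:-_)

    ⊖-+-⊖ : ∀ a b c d → (a ⊖ b) ℤ.+ (c ⊖ d) ≡ (a ℕ.+ c) ⊖ (b ℕ.+ d)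
    ⊖-+-⊖ a b c d = ≡.trans
      (≡.cong₂ ℤ._+_ (≡.sym (ℤ.m-n≡m⊖n a b)) (≡.sym (ℤ.m-n≡m⊖n c d)))
      (≡.trans (solve 4 (λ a b c d → (a :- b) :+ (c :- d) := (a :+ c) :- (b :+ d)) ≡.refl
                        (+ a) (+ b) (+ c) (+ d))
               (ℤ.m-n≡m⊖n (a ℕ.+ c) (b ℕ.+ d)))

    ⊖-*-⊖ : ∀ a b c d → (a ⊖ b) ℤ.* (c ⊖ d) ≡ (a ℕ.* c ℕ.+ b ℕ.* d) ⊖ (a ℕ.* d ℕ.+ b ℕ.* c)
    ⊖-*-⊖ a b c d = ≡.trans
      (≡.cong₂ ℤ._*_ (≡.sym (ℤ.m-n≡m⊖n a b)) (≡.sym (ℤ.m-n≡m⊖n c d)))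
      (≡.trans (solve 4 (λ a b c d → (a :- b) :* (c :- d) := (a :* c :+ b :* d) :- (a :* d :+ b :* c))
                        ≡.refl (+ a) (+ b) (+ c) (+ d))
               (≡.trans (≡.cong₂ ℤ._-_ (≡.cong₂ ℤ._+_ (≡.sym (ℤ.pos-* a c)) (≡.sym (ℤ.pos-* b d)))
                                        (≡.cong₂ ℤ._+_ (≡.sym (ℤ.pos-* a d)) (≡.sym (ℤ.pos-* b c))))
                        (ℤ.m-n≡m⊖n (a ℕ.* c ℕ.+ b ℕ.* d) (a ℕ.* d ℕ.+ b ℕ.* c))))

    fromℕ-+-* : ∀ a b c d → fromℕ (a ℕ.* b ℕ.+ c ℕ.* d) ≈ fromℕ a * fromℕ b + fromℕ c * fromℕ d
    fromℕ-+-* a b c d = trans (×-homo-+ 1# (a ℕ.* b) (c ℕ.* d)) (+-cong (×1-homo-* a b) (×1-homo-* c d))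

    fromℤ-+ : ∀ i j → fromℤ (i ℤ.+ j) ≈ fromℤ i + fromℤ j
    fromℤ-+ i j = begin
      fromℤ (i ℤ.+ j)                     ≡⟨ ≡.cong fromℤ (≡.cong₂ ℤ._+_ (≡positivePart⊖negativePart i)
                                                                        (≡positivePart⊖negativePart j)) ⟩
      fromℤ ((a ⊖ b) ℤ.+ (c ⊖ d))         ≡⟨ ≡.cong fromℤ (⊖-+-⊖ a b c d) ⟩
      fromℤ ((a ℕ.+ c) ⊖ (b ℕ.+ d))       ≈⟨ fromℤ-⊖ (a ℕ.+ c) (b ℕ.+ d) ⟩
      fromℕ (a ℕ.+ c) - fromℕ (b ℕ.+ d)   ≈⟨ +-cong (×-homo-+ 1# a c) (-‿cong (×-homo-+ 1# b d)) ⟩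
      (fromℕ a + fromℕ c) - (fromℕ b + fromℕ d) ≈⟨ [x+y]-[u+v]≈[x-u]+[y-v] (fromℕ a) (fromℕ c) (fromℕ b) (fromℕ d) ⟩
      (fromℕ a - fromℕ b) + (fromℕ c - fromℕ d) ≈⟨ +-cong (fromℤ-parts i) (fromℤ-parts j) ⟨
      fromℤ i + fromℤ j                   ∎
      where
      a = positivePart i
      b = negativePart i
      c = positivePart j
      d = negativePart j

    fromℤ-* : ∀ i j → fromℤ (i ℤ.* j) ≈ fromℤ i * fromℤ j
    fromℤ-* i j = begin
      fromℤ (i ℤ.* j)                     ≡⟨ ≡.cong fromℤ (≡.cong₂ ℤ._*_ (≡positivePart⊖negativePart i)
                                                                        (≡positivePart⊖negativePart j)) ⟩
      fromℤ ((a ⊖ b) ℤ.* (c ⊖ d))         ≡⟨ ≡.cong fromℤ (⊖-*-⊖ a b c d) ⟩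
      fromℤ ((a ℕ.* c ℕ.+ b ℕ.* d) ⊖ (a ℕ.* d ℕ.+ b ℕ.* c))
        ≈⟨ fromℤ-⊖ (a ℕ.* c ℕ.+ b ℕ.* d) (a ℕ.* d ℕ.+ b ℕ.* c) ⟩
      fromℕ (a ℕ.* c ℕ.+ b ℕ.* d) - fromℕ (a ℕ.* d ℕ.+ b ℕ.* c)
        ≈⟨ +-cong (fromℕ-+-* a c b d) (-‿cong (fromℕ-+-* a d b c)) ⟩
      (fromℕ a * fromℕ c + fromℕ b * fromℕ d) - (fromℕ a * fromℕ d + fromℕ b * fromℕ c)
        ≈⟨ [x-y][u-v]≈[xu+yv]-[xv+yu] (fromℕ a) (fromℕ b) (fromℕ c) (fromℕ d) ⟨
      (fromℕ a - fromℕ b) * (fromℕ c - fromℕ d) ≈⟨ *-cong (fromℤ-parts i) (fromℤ-parts j) ⟨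
      fromℤ i * fromℤ j                   ∎
      where
      a = positivePart i
      b = negativePart i
      c = positivePart j
      d = negativePart j

    fromℤ-neg : ∀ i → fromℤ (ℤ.- i) ≈ - fromℤ i
    fromℤ-neg i = begin
      fromℤ (ℤ.- i)                       ≡⟨ ≡.cong (λ k → fromℤ (ℤ.- k)) (≡positivePart⊖negativePart i) ⟩
      fromℤ (ℤ.- (a ⊖ b))                 ≡⟨ ≡.cong fromℤ (≡.sym (ℤ.⊖-swap b a)) ⟩
      fromℤ (b ⊖ a)                       ≈⟨ fromℤ-⊖ b a ⟩
      fromℕ b - fromℕ a                   ≈⟨ ⁻¹-anti-homo‿- (fromℕ a) (fromℕ b) ⟨
      - (fromℕ a - fromℕ b)               ≈⟨ -‿cong (fromℤ-parts i) ⟨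
      - fromℤ i                           ∎
      where
      a = positivePart i
      b = negativePart i

    homomorphism : ℤ.+-*-rawRing -Raw-AlmostCommutative⟶ fromCommutativeRing R
    homomorphism = record
      { ⟦_⟧    = fromℤ
      ; +-homo = fromℤ-+
      ; *-homo = fromℤ-*
      ; -‿homo = fromℤ-neg
      ; 0-homo = refl
      ; 1-homo = refl
      }

    fromℤ-≟ : ∀ i j → Maybe (fromℤ i ≈ fromℤ j)
    fromℤ-≟ i j with i ℤ.≟ j
    ... | yes ≡.refl = just refl
    ... | no _       = nothing

  open import Algebra.Solver.Ring ℤ.+-*-rawRing (fromCommutativeRing R) homomorphism fromℤ-≟ public

  :1 : ∀ {n} → Polynomial n
  :1 = con (+ 1)

module CommutativeRingLemmas {r₁ r₂} (R : CommutativeRing r₁ r₂) where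

  open CommutativeRing R
  open IntegerCoefficientSolver R using (solve; _:=_; _:+_; _:*_; _:-_; :1)
  open import Algebra.Properties.CommutativeSemiring.Exp commutativeSemiring using (_^_; ^-congˡ; ^-distrib-*)
  open import Data.Nat using (zero; suc)
  open import Relation.Binary.Reasoning.Setoid setoid

  inverse-unique : ∀ {p a b} → a * p ≈ 1# → b * p ≈ 1# → a ≈ b
  inverse-unique {p} {a} {b} ap≈1 bp≈1 = begin
    a             ≈⟨ *-identityʳ a ⟨
    a * 1#        ≈⟨ *-congˡ bp≈1 ⟨
    a * (b * p)   ≈⟨ solve 3 (λ a b p → a :* (b :* p) := b :* (a :* p)) refl a b p ⟩
    b * (a * p)   ≈⟨ *-congˡ ap≈1 ⟩
    b * 1#        ≈⟨ *-identityʳ b ⟩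
    b             ∎

  1^n≈1 : ∀ n → 1# ^ n ≈ 1#
  1^n≈1 zero    = refl
  1^n≈1 (suc n) = trans (*-identityˡ _) (1^n≈1 n)

  ^-inverse : ∀ {a b} n → a * b ≈ 1# → a ^ n * b ^ n ≈ 1#
  ^-inverse {a} {b} n ab≈1 = begin
    a ^ n * b ^ n ≈⟨ ^-distrib-* a b n ⟨
    (a * b) ^ n   ≈⟨ ^-congˡ n ab≈1 ⟩
    1# ^ n        ≈⟨ 1^n≈1 n ⟩
    1#            ∎

  -- W - 1 = Z + Z Y (W - 1), so (W - 1)(1 - Y Z) = Z.
  affine-fixedPoint : ∀ W Z Y G → W ≈ 1# + Z * (1# + Y * (W - 1#)) → (1# - Y * Z) * G ≈ 1# →
                      W ≈ 1# + Z * G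
  affine-fixedPoint W Z Y G W≈ YZ-inverse = begin
    W                                          ≈⟨ solve 1 (λ W → W := :1 :+ (W :- :1) :* :1) refl W ⟩
    1# + (W - 1#) * 1#                         ≈⟨ +-congˡ (*-congˡ YZ-inverse) ⟨
    1# + (W - 1#) * ((1# - Y * Z) * G)
      ≈⟨ solve 4 (λ W Z Y G → :1 :+ (W :- :1) :* ((:1 :- Y :* Z) :* G)
                            := :1 :+ (W :- :1 :- Z :* (Y :* (W :- :1))) :* G) refl W Z Y G ⟩
    1# + (W - 1# - Z * (Y * (W - 1#))) * G     ≈⟨ +-congˡ (*-congʳ (+-congʳ (+-congʳ W≈))) ⟩
    1# + (1# + Z * (1# + Y * (W - 1#)) - 1# - Z * (Y * (W - 1#))) * G
      ≈⟨ solve 4 (λ W Z Y G → :1 :+ (:1 :+ Z :* (:1 :+ Y :* (W :- :1)) :- :1 :- Z :* (Y :* (W :- :1))) :* G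
                            := :1 :+ Z :* G) refl W Z Y G ⟩
    1# + Z * G                                 ∎

  fixedPoint-inverse : ∀ W u → W ≈ 1# + u * W → W * (1# - u) ≈ 1#
  fixedPoint-inverse W u W≈ = begin
    W * (1# - u)       ≈⟨ solve 2 (λ W u → W :* (:1 :- u) := W :- u :* W) refl W u ⟩
    W - u * W          ≈⟨ +-congʳ W≈ ⟩
    1# + u * W - u * W ≈⟨ solve 2 (λ W u → :1 :+ u :* W :- u :* W := :1) refl W u ⟩
    1#                 ∎

  continuedFraction-step : ∀ w a a′ e g g′ Q x →
    w ≈ a + e * g →
    a′ * (1# - x * a) ≈ 1# →
    Q * g ≈ 1# →
    (Q - a′ * x * e) * g′ ≈ 1# →
    (a′ + a′ * a′ * x * e * g′) * (1# - x * w) ≈ 1#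
  continuedFraction-step w a a′ e g g′ Q x w≈ a′-inverse g-inverse g′-inverse = begin
    (a′ + a′ * a′ * x * e * g′) * (1# - x * w)       ≈⟨ *-congˡ (+-congˡ (-‿cong (*-congˡ w≈))) ⟩
    (a′ + a′ * a′ * x * e * g′) * (1# - x * (a + e * g))
      ≈⟨ solve 6 (λ a′ x e g′ a g → (a′ :+ a′ :* a′ :* x :* e :* g′) :* (:1 :- x :* (a :+ e :* g))
                   := (:1 :+ a′ :* x :* e :* g′) :* (a′ :* (:1 :- x :* a)) :- (:1 :+ a′ :* x :* e :* g′) :* (a′ :* x :* e) :* g)
                 refl a′ x e g′ a g ⟩
    (1# + u * g′) * (a′ * (1# - x * a)) - (1# + u * g′) * u * g ≈⟨ +-congʳ (*-congˡ a′-inverse) ⟩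
    (1# + u * g′) * 1# - (1# + u * g′) * u * g
      ≈⟨ solve 3 (λ u g g′ → (:1 :+ u :* g′) :* :1 :- (:1 :+ u :* g′) :* u :* g
                           := :1 :+ u :* g′ :* :1 :- u :* g :* :1 :- u :* u :* g :* g′) refl u g g′ ⟩
    1# + u * g′ * 1# - u * g * 1# - u * u * g * g′
      ≈⟨ +-congʳ (+-cong (+-congˡ (*-congˡ g-inverse)) (-‿cong (*-congˡ g′-inverse))) ⟨
    1# + u * g′ * (Q * g) - u * g * ((Q - u) * g′) - u * u * g * g′
      ≈⟨ solve 4 (λ u g g′ Q → :1 :+ u :* g′ :* (Q :* g) :- u :* g :* ((Q :- u) :* g′) :- u :* u :* g :* g′ := :1)
                 refl u g g′ Q ⟩
    1#                                               ∎
    where u = a′ * x * e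

module PowerSeries {r₁ r₂} (Coefficients : CommutativeRing r₁ r₂) where

  open import Algebra.Structures using (IsCommutativeRing)
  import Algebra.Properties.CommutativeSemigroup as CommutativeSemigroupProperties
  import Algebra.Properties.Group as GroupProperties
  import Relation.Binary.Reasoning.Setoid
  open import Data.Integer using (0ℤ)
  open import Data.Nat as ℕ using (ℕ; zero; suc; _∸_; _≤_; _<_; z≤n; s≤s)
  import Data.Nat.Properties as ℕ
  open import Data.Product using (_,_)
  import Relation.Binary.PropositionalEquality as ≡

  module K = CommutativeRing Coefficients
  open K using (Carrier; 0#; 1#; _≈_)
  private module ≈ᴷ = Relation.Binary.Reasoning.Setoid K.setoid
  open CommutativeSemigroupProperties K.+-commutativeSemigroup using (interchange)
  open GroupProperties K.+-group using (ε⁻¹≈ε)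

  Series : Set r₁
  Series = ℕ → Carrier

  Σ≤ : ℕ → (ℕ → Carrier) → Carrier
  Σ≤ zero    F = F 0
  Σ≤ (suc n) F = Σ≤ n F K.+ F (suc n)

  infixl 6 _⊕_
  infixl 7 _⊛_
  infix  8 ⊝_

  -- Defined by cases on the index, so that (f ⊕ g) n does not unfold for a variable n:
  -- this keeps f and g inferable when unifying with a sum of series.
  _⊕_ : Series → Series → Series
  (f ⊕ g) zero    = f zero K.+ g zero
  (f ⊕ g) (suc n) = f (suc n) K.+ g (suc n)

  ⊝_ : Series → Series
  (⊝ f) zero    = K.- f zero
  (⊝ f) (suc n) = K.- f (suc n)

  ⊕-coeff : ∀ f g n → (f ⊕ g) n ≈ f n K.+ g n
  ⊕-coeff f g zero    = K.refl
  ⊕-coeff f g (suc n) = K.refl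

  ⊝-coeff : ∀ f n → (⊝ f) n ≈ K.- f n
  ⊝-coeff f zero    = K.refl
  ⊝-coeff f (suc n) = K.refl

  constant : Carrier → Series
  constant c zero    = c
  constant c (suc n) = 0#

  𝟎 𝟏 𝐗 : Series
  𝟎 n = 0#
  𝟏 = constant 1#
  𝐗 zero          = 0#
  𝐗 (suc zero)    = 1#
  𝐗 (suc (suc n)) = 0#

  shift : Series → Series
  shift f n = f (suc n)

  scale : Carrier → Series → Series
  scale c f n = c K.* f n

  _⊛_ : Series → Series → Series
  (f ⊛ g) zero    = f 0 K.* g 0
  (f ⊛ g) (suc n) = f 0 K.* g (suc n) K.+ (shift f ⊛ g) n

  -- A record rather than ∀ n → f n ≈ g n, so that f and g can be inferred from f ≐ g.
  infix 4 _≐_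
  record _≐_ (f g : Series) : Set r₂ where
    constructor coefficientwise
    field coeff : ∀ n → f n ≈ g n
  open _≐_ public

  ⊛-cong : ∀ {f f′ g g′} → (∀ n → f n ≈ f′ n) → (∀ n → g n ≈ g′ n) → ∀ n → (f ⊛ g) n ≈ (f′ ⊛ g′) n
  ⊛-cong p q zero    = K.*-cong (p 0) (q 0)
  ⊛-cong p q (suc n) = K.+-cong (K.*-cong (p 0) (q (suc n))) (⊛-cong (λ k → p (suc k)) q n)

  ⊛-congʳ-upTo : ∀ f {g h} n → (∀ i → i ≤ n → g i ≈ h i) → (f ⊛ g) n ≈ (f ⊛ h) n
  ⊛-congʳ-upTo f zero    q = K.*-congˡ (q 0 z≤n)
  ⊛-congʳ-upTo f (suc n) q = K.+-cong (K.*-congˡ (q (suc n) ℕ.≤-refl))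
    (⊛-congʳ-upTo (shift f) n (λ i i≤n → q i (ℕ.m≤n⇒m≤1+n i≤n)))

  ⊛-zeroˡ : ∀ g n → (𝟎 ⊛ g) n ≈ 0#
  ⊛-zeroˡ g zero    = K.zeroˡ (g 0)
  ⊛-zeroˡ g (suc n) = K.trans (K.+-cong (K.zeroˡ _) (⊛-zeroˡ g n)) (K.+-identityˡ 0#)

  constant-⊛ : ∀ c f n → (constant c ⊛ f) n ≈ c K.* f n
  constant-⊛ c f zero    = K.refl
  constant-⊛ c f (suc n) = K.trans (K.+-congˡ (⊛-zeroˡ f n)) (K.+-identityʳ _)

  ⊛-identityˡ : ∀ g n → (𝟏 ⊛ g) n ≈ g n
  ⊛-identityˡ g n = K.trans (constant-⊛ 1# g n) (K.*-identityˡ (g n))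

  ⊛-distribʳ : ∀ h f g n → ((f ⊕ g) ⊛ h) n ≈ (f ⊛ h ⊕ g ⊛ h) n
  ⊛-distribʳ h f g zero    = K.distribʳ (h 0) (f 0) (g 0)
  ⊛-distribʳ h f g (suc n) = begin
    (f 0 K.+ g 0) K.* h (suc n) K.+ (shift (f ⊕ g) ⊛ h) n
      ≈⟨ K.+-cong (K.distribʳ (h (suc n)) (f 0) (g 0))
                  (K.trans (⊛-cong (λ k → K.sym (⊕-coeff (shift f) (shift g) k)) (λ _ → K.refl) n)
                           (K.trans (⊛-distribʳ h (shift f) (shift g) n) (⊕-coeff _ _ n))) ⟩
    (f 0 K.* h (suc n) K.+ g 0 K.* h (suc n)) K.+ ((shift f ⊛ h) n K.+ (shift g ⊛ h) n)
      ≈⟨ interchange _ _ _ _ ⟩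
    (f ⊛ h ⊕ g ⊛ h) (suc n) ∎
    where open ≈ᴷ

  ⊛-distribˡ : ∀ h f g n → (h ⊛ (f ⊕ g)) n ≈ (h ⊛ f ⊕ h ⊛ g) n
  ⊛-distribˡ h f g zero    = K.distribˡ (h 0) (f 0) (g 0)
  ⊛-distribˡ h f g (suc n) = begin
    h 0 K.* (f (suc n) K.+ g (suc n)) K.+ (shift h ⊛ (f ⊕ g)) n
      ≈⟨ K.+-cong (K.distribˡ (h 0) (f (suc n)) (g (suc n))) (K.trans (⊛-distribˡ (shift h) f g n) (⊕-coeff _ _ n)) ⟩
    (h 0 K.* f (suc n) K.+ h 0 K.* g (suc n)) K.+ ((shift h ⊛ f) n K.+ (shift h ⊛ g) n)
      ≈⟨ interchange _ _ _ _ ⟩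
    (h ⊛ f ⊕ h ⊛ g) (suc n) ∎
    where open ≈ᴷ

  scale-⊛ : ∀ c f g n → (scale c f ⊛ g) n ≈ c K.* (f ⊛ g) n
  scale-⊛ c f g zero    = K.*-assoc c (f 0) (g 0)
  scale-⊛ c f g (suc n) = K.trans (K.+-cong (K.*-assoc c (f 0) (g (suc n))) (scale-⊛ c (shift f) g n))
                                  (K.sym (K.distribˡ c _ _))

  ⊛-shiftʳ : ∀ f g n → (f ⊛ g) (suc n) ≈ (f ⊛ shift g) n K.+ f (suc n) K.* g 0
  ⊛-shiftʳ f g zero    = K.refl
  ⊛-shiftʳ f g (suc n) = begin
    f 0 K.* g (suc (suc n)) K.+ (shift f ⊛ g) (suc n)
      ≈⟨ K.+-congˡ (⊛-shiftʳ (shift f) g n) ⟩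
    f 0 K.* g (suc (suc n)) K.+ ((shift f ⊛ shift g) n K.+ f (suc (suc n)) K.* g 0)
      ≈⟨ K.+-assoc _ _ _ ⟨
    (f ⊛ shift g) (suc n) K.+ f (suc (suc n)) K.* g 0 ∎
    where open ≈ᴷ

  ⊛-comm : ∀ f g n → (f ⊛ g) n ≈ (g ⊛ f) n
  ⊛-comm f g zero    = K.*-comm (f 0) (g 0)
  ⊛-comm f g (suc n) = begin
    f 0 K.* g (suc n) K.+ (shift f ⊛ g) n ≈⟨ K.+-cong (K.*-comm _ _) (⊛-comm (shift f) g n) ⟩
    g (suc n) K.* f 0 K.+ (g ⊛ shift f) n ≈⟨ K.+-comm _ _ ⟩
    (g ⊛ shift f) n K.+ g (suc n) K.* f 0 ≈⟨ ⊛-shiftʳ g f n ⟨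
    (g ⊛ f) (suc n)                       ∎
    where open ≈ᴷ

  ⊛-assoc : ∀ f g h n → ((f ⊛ g) ⊛ h) n ≈ (f ⊛ (g ⊛ h)) n
  ⊛-assoc f g h zero    = K.*-assoc (f 0) (g 0) (h 0)
  ⊛-assoc f g h (suc n) = begin
    (f 0 K.* g 0) K.* h (suc n) K.+ (shift (f ⊛ g) ⊛ h) n
      ≈⟨ K.+-cong (K.*-assoc _ _ _) (⊛-cong (λ k → K.sym (⊕-coeff (scale (f 0) (shift g)) (shift f ⊛ g) k))
                                             (λ _ → K.refl) n) ⟩
    f 0 K.* (g 0 K.* h (suc n)) K.+ ((scale (f 0) (shift g) ⊕ shift f ⊛ g) ⊛ h) n
      ≈⟨ K.+-congˡ (K.trans (⊛-distribʳ h (scale (f 0) (shift g)) (shift f ⊛ g) n) (⊕-coeff _ _ n)) ⟩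
    f 0 K.* (g 0 K.* h (suc n)) K.+ ((scale (f 0) (shift g) ⊛ h) n K.+ ((shift f ⊛ g) ⊛ h) n)
      ≈⟨ K.+-congˡ (K.+-cong (scale-⊛ (f 0) (shift g) h n) (⊛-assoc (shift f) g h n)) ⟩
    f 0 K.* (g 0 K.* h (suc n)) K.+ (f 0 K.* (shift g ⊛ h) n K.+ (shift f ⊛ (g ⊛ h)) n)
      ≈⟨ K.+-assoc _ _ _ ⟨
    (f 0 K.* (g 0 K.* h (suc n)) K.+ f 0 K.* (shift g ⊛ h) n) K.+ (shift f ⊛ (g ⊛ h)) n
      ≈⟨ K.+-congʳ (K.distribˡ _ _ _) ⟨
    (f ⊛ (g ⊛ h)) (suc n) ∎
    where open ≈ᴷ

  isCommutativeRing : IsCommutativeRing _≐_ _⊕_ _⊛_ ⊝_ 𝟎 𝟏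
  isCommutativeRing = record
    { isRing = record
      { +-isAbelianGroup = record
        { isGroup = record
          { isMonoid = record
            { isSemigroup = record
              { isMagma = record
                { isEquivalence = record
                  { refl  = coefficientwise (λ _ → K.refl)
                  ; sym   = λ p → coefficientwise (λ n → K.sym (coeff p n))
                  ; trans = λ p q → coefficientwise (λ n → K.trans (coeff p n) (coeff q n))
                  }
                ; ∙-cong = λ p q → coefficientwise λ { zero    → K.+-cong (coeff p zero) (coeff q zero)
                                                     ; (suc n) → K.+-cong (coeff p (suc n)) (coeff q (suc n)) }
                }
              ; assoc = λ f g h → coefficientwise λ { zero → K.+-assoc _ _ _ ; (suc n) → K.+-assoc _ _ _ }
              }
            ; identity = (λ f → coefficientwise λ { zero → K.+-identityˡ _ ; (suc n) → K.+-identityˡ _ })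
                       , (λ f → coefficientwise λ { zero → K.+-identityʳ _ ; (suc n) → K.+-identityʳ _ })
            }
          ; inverse = (λ f → coefficientwise λ { zero → K.-‿inverseˡ _ ; (suc n) → K.-‿inverseˡ _ })
                    , (λ f → coefficientwise λ { zero → K.-‿inverseʳ _ ; (suc n) → K.-‿inverseʳ _ })
          ; ⁻¹-cong = λ p → coefficientwise λ { zero    → K.-‿cong (coeff p zero)
                                             ; (suc n) → K.-‿cong (coeff p (suc n)) }
          }
        ; comm = λ f g → coefficientwise λ { zero → K.+-comm _ _ ; (suc n) → K.+-comm _ _ }
        }
      ; *-cong     = λ p q → coefficientwise (⊛-cong (coeff p) (coeff q))
      ; *-assoc    = λ f g h → coefficientwise (⊛-assoc f g h)
      ; *-identity = (λ g → coefficientwise (⊛-identityˡ g))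
                   , (λ g → coefficientwise (λ n → K.trans (⊛-comm g 𝟏 n) (⊛-identityˡ g n)))
      ; distrib    = (λ h f g → coefficientwise (⊛-distribˡ h f g))
                   , (λ h f g → coefficientwise (⊛-distribʳ h f g))
      }
    ; *-comm = λ f g → coefficientwise (⊛-comm f g)
    }

  powerSeriesRing : CommutativeRing r₁ r₂
  powerSeriesRing = record { isCommutativeRing = isCommutativeRing }

  private module P = CommutativeRing powerSeriesRing
  open P using (_-_) renaming (setoid to seriesSetoid)
  open import Algebra.Properties.CommutativeSemiring.Exp
    (CommutativeRing.commutativeSemiring powerSeriesRing) public using (_^_; ^-congˡ; ^-distrib-*)
  private module S = IntegerCoefficientSolver powerSeriesRing
  private module KS = IntegerCoefficientSolver Coefficients
  private module ≈ₛ = Relation.Binary.Reasoning.Setoid seriesSetoid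
  open S using (solve; _:=_; _:+_; _:*_; _:-_; :1)

  Σ≤-cong : ∀ n {F G} → (∀ i → F i ≈ G i) → Σ≤ n F ≈ Σ≤ n G
  Σ≤-cong zero    p = p 0
  Σ≤-cong (suc n) p = K.+-cong (Σ≤-cong n p) (p (suc n))

  Σ≤-suc : ∀ n F → Σ≤ (suc n) F ≈ F 0 K.+ Σ≤ n (λ i → F (suc i))
  Σ≤-suc zero    F = K.refl
  Σ≤-suc (suc n) F = K.trans (K.+-congʳ (Σ≤-suc n F)) (K.+-assoc _ _ _)

  ⊛-convolution : ∀ f g n → (f ⊛ g) n ≈ Σ≤ n (λ i → f i K.* g (n ∸ i))
  ⊛-convolution f g zero    = K.refl
  ⊛-convolution f g (suc n) =
    K.trans (K.+-congˡ (⊛-convolution (shift f) g n)) (K.sym (Σ≤-suc n (λ i → f i K.* g (suc n ∸ i))))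

  ⊛-vanishes : ∀ h {g} n → (∀ i → i ≤ n → g i ≈ 0#) → (h ⊛ g) n ≈ 0#
  ⊛-vanishes h zero    q = K.trans (K.*-congˡ (q 0 z≤n)) (K.zeroʳ _)
  ⊛-vanishes h (suc n) q = K.trans
    (K.+-cong (K.trans (K.*-congˡ (q (suc n) ℕ.≤-refl)) (K.zeroʳ _))
              (⊛-vanishes (shift h) n (λ i i≤n → q i (ℕ.m≤n⇒m≤1+n i≤n))))
    (K.+-identityˡ 0#)

  ^-vanishes-below : ∀ g → g 0 ≈ 0# → ∀ j n → n < j → (g ^ j) n ≈ 0#
  ^-vanishes-below g g₀≈0 (suc j) zero    _         = K.trans (K.*-congʳ g₀≈0) (K.zeroˡ _)
  ^-vanishes-below g g₀≈0 (suc j) (suc n) (s≤s n<j) = K.trans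
    (K.+-cong (K.trans (K.*-congʳ g₀≈0) (K.zeroˡ _))
              (⊛-vanishes (shift g) n (λ i i≤n → ^-vanishes-below g g₀≈0 j i (ℕ.<-≤-trans (s≤s i≤n) n<j))))
    (K.+-identityˡ 0#)

  geometricSum : Series → ℕ → Series
  geometricSum g zero    = 𝟏
  geometricSum g (suc N) = geometricSum g N ⊕ g ^ suc N

  geometricSum-telescopes : ∀ g N → (𝟏 - g) ⊛ geometricSum g N ≐ 𝟏 - g ^ suc N
  geometricSum-telescopes g zero    = solve 1 (λ g → (:1 :- g) :* :1 := :1 :- g :* :1) P.refl g
  geometricSum-telescopes g (suc N) = begin
    (𝟏 - g) ⊛ (geometricSum g N ⊕ g ^ suc N)
      ≈⟨ solve 3 (λ g s p → (:1 :- g) :* (s :+ p) := (:1 :- g) :* s :+ (:1 :- g) :* p) P.refl g (geometricSum g N) (g ^ suc N) ⟩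
    (𝟏 - g) ⊛ geometricSum g N ⊕ (𝟏 - g) ⊛ g ^ suc N
      ≈⟨ P.+-congʳ (geometricSum-telescopes g N) ⟩
    (𝟏 - g ^ suc N) ⊕ (𝟏 - g) ⊛ g ^ suc N
      ≈⟨ solve 2 (λ g p → (:1 :- p) :+ (:1 :- g) :* p := :1 :- g :* p) P.refl g (g ^ suc N) ⟩
    𝟏 - g ^ suc (suc N) ∎
    where open ≈ₛ

  geometricSum-coeff : ∀ g N n → geometricSum g N n ≈ Σ≤ N (λ j → (g ^ j) n)
  geometricSum-coeff g zero    n = K.refl
  geometricSum-coeff g (suc N) n = K.trans (⊕-coeff _ _ n) (K.+-congʳ (geometricSum-coeff g N n))

  geometricSum-stable : ∀ g → g 0 ≈ 0# → ∀ d n → geometricSum g (d ℕ.+ n) n ≈ geometricSum g n n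
  geometricSum-stable g g₀≈0 zero    n = K.refl
  geometricSum-stable g g₀≈0 (suc d) n = begin
    geometricSum g (suc d ℕ.+ n) n    ≈⟨ ⊕-coeff _ _ n ⟩
    geometricSum g (d ℕ.+ n) n K.+ (g ^ suc (d ℕ.+ n)) n
      ≈⟨ K.+-congˡ (^-vanishes-below g g₀≈0 (suc (d ℕ.+ n)) n (s≤s (ℕ.m≤n+m n d))) ⟩
    geometricSum g (d ℕ.+ n) n K.+ 0# ≈⟨ K.+-identityʳ _ ⟩
    geometricSum g (d ℕ.+ n) n        ≈⟨ geometricSum-stable g g₀≈0 d n ⟩
    geometricSum g n n                ∎
    where open ≈ᴷ

  -- 1/f = Σⱼ (1 - f)ʲ; only j ≤ n contribute to the n-th coefficient.
  inv : Series → Series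
  inv f n = Σ≤ n (λ j → ((𝟏 - f) ^ j) n)

  inv-cong : ∀ {f g} → f ≐ g → inv f ≐ inv g
  inv-cong f≐g = coefficientwise λ n →
    Σ≤-cong n (λ j → coeff (^-congˡ j (P.+-congˡ (P.-‿cong f≐g))) n)

  ⊛-inv : ∀ f → f 0 ≈ 1# → f ⊛ inv f ≐ 𝟏
  ⊛-inv f f₀≈1 = coefficientwise λ n → begin
    (f ⊛ inv f) n             ≈⟨ ⊛-congʳ-upTo f n (λ i i≤n → inv≈geometricSum i n i≤n) ⟩
    (f ⊛ geometricSum g n) n  ≈⟨ coeff (P.*-congʳ f≈1-g) n ⟩
    ((𝟏 - g) ⊛ geometricSum g n) n ≈⟨ coeff (geometricSum-telescopes g n) n ⟩
    (𝟏 - g ^ suc n) n         ≈⟨ K.trans (⊕-coeff _ _ n) (K.+-congˡ (⊝-coeff _ n)) ⟩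
    𝟏 n K.- (g ^ suc n) n     ≈⟨ K.+-congˡ (K.-‿cong (^-vanishes-below g g₀≈0 (suc n) n ℕ.≤-refl)) ⟩
    𝟏 n K.- 0#                ≈⟨ K.trans (K.+-congˡ ε⁻¹≈ε) (K.+-identityʳ _) ⟩
    𝟏 n                       ∎
    where
    open ≈ᴷ
    g = 𝟏 - f
    g₀≈0 : g 0 ≈ 0#
    g₀≈0 = K.trans (K.+-congˡ (K.-‿cong f₀≈1)) (K.-‿inverseʳ 1#)
    f≈1-g : f ≐ 𝟏 - g
    f≈1-g = solve 1 (λ f → f := :1 :- (:1 :- f)) P.refl f
    inv≈geometricSum : ∀ i n → i ≤ n → inv f i ≈ geometricSum g n i
    inv≈geometricSum i n i≤n = begin
      inv f i                          ≈⟨ geometricSum-coeff g i i ⟨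
      geometricSum g i i               ≈⟨ geometricSum-stable g g₀≈0 (n ∸ i) i ⟨
      geometricSum g (n ∸ i ℕ.+ i) i   ≡⟨ ≡.cong (λ m → geometricSum g m i) (ℕ.m∸n+n≡m i≤n) ⟩
      geometricSum g n i               ∎

  ^-constantTerm : ∀ f m → f 0 ≈ 1# → (f ^ m) 0 ≈ 1#
  ^-constantTerm f zero    f₀≈1 = K.refl
  ^-constantTerm f (suc m) f₀≈1 = K.trans (K.*-cong f₀≈1 (^-constantTerm f m f₀≈1)) (K.*-identityˡ 1#)

  inv-^ : ∀ f m → f 0 ≈ 1# → inv (f ^ m) ≐ inv f ^ m
  inv-^ f m f₀≈1 = inverse-unique (P.trans (P.*-comm _ _) (⊛-inv (f ^ m) (^-constantTerm f m f₀≈1)))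
                                  (^-inverse m (P.trans (P.*-comm _ _) (⊛-inv f f₀≈1)))
    where open CommutativeRingLemmas powerSeriesRing using (inverse-unique; ^-inverse)

  constant-cong : ∀ {a b} → a ≈ b → constant a ≐ constant b
  constant-cong a≈b = coefficientwise λ { zero → a≈b ; (suc n) → K.refl }

  constant-+ : ∀ a b → constant (a K.+ b) ≐ constant a ⊕ constant b
  constant-+ a b = coefficientwise λ { zero → K.refl ; (suc n) → K.sym (K.+-identityˡ 0#) }

  constant-* : ∀ a b → constant (a K.* b) ≐ constant a ⊛ constant b
  constant-* a b = coefficientwise λ n → K.sym (K.trans (constant-⊛ a (constant b) n) (scale-constant n))
    where
    scale-constant : ∀ n → a K.* constant b n ≈ constant (a K.* b) n
    scale-constant zero    = K.refl
    scale-constant (suc n) = K.zeroʳ a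

  constant-neg : ∀ a → constant (K.- a) ≐ ⊝ constant a
  constant-neg a = coefficientwise λ { zero → K.refl ; (suc n) → K.sym ε⁻¹≈ε }

  constant-sub : ∀ a b → constant (a K.- b) ≐ constant a - constant b
  constant-sub a b = P.trans (constant-+ a (K.- b)) (P.+-congˡ (constant-neg b))

  𝐗-⊛-zero : ∀ f → (𝐗 ⊛ f) 0 ≈ 0#
  𝐗-⊛-zero f = K.zeroˡ (f 0)

  𝐗-⊛-suc : ∀ f n → (𝐗 ⊛ f) (suc n) ≈ f n
  𝐗-⊛-suc f n = K.trans (K.+-cong (K.zeroˡ _) (K.trans (⊛-cong shift-𝐗 (λ _ → K.refl) n) (⊛-identityˡ f n)))
                        (K.+-identityˡ _)
    where
    shift-𝐗 : ∀ n → shift 𝐗 n ≈ 𝟏 n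
    shift-𝐗 zero    = K.refl
    shift-𝐗 (suc n) = K.refl

  open import Algebra.Properties.CommutativeSemiring.Exp K.commutativeSemiring
    using () renaming (_^_ to _^ᴷ_)

  -- The coefficients of 1/(c - d x) = c⁻¹ Σᵣ (d c⁻¹)ʳ xʳ.
  geometric : Carrier → Carrier → Series
  geometric c⁻¹ d r = d ^ᴷ r K.* c⁻¹ ^ᴷ suc r

  geometric-inverse : ∀ c c⁻¹ d → c K.* c⁻¹ ≈ 1# → (constant c - 𝐗 ⊛ constant d) ⊛ geometric c⁻¹ d ≐ 𝟏
  geometric-inverse c c⁻¹ d cc⁻¹≈1 = coefficientwise λ
    { zero    → begin
        (c K.- 0# K.* d) K.* (1# K.* (c⁻¹ K.* 1#))
          ≈⟨ KS.solve 3 (λ c c⁻¹ d → (c KS.:- KS.con 0ℤ KS.:* d) KS.:* (KS.:1 KS.:* (c⁻¹ KS.:* KS.:1))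
                                     KS.:= c KS.:* c⁻¹) K.refl c c⁻¹ d ⟩
        c K.* c⁻¹ ≈⟨ cc⁻¹≈1 ⟩
        1#        ∎
    ; (suc r) → begin
        (c K.- 0# K.* d) K.* geometric c⁻¹ d (suc r) K.+ (shift P ⊛ geometric c⁻¹ d) r
          ≈⟨ K.+-congˡ (⊛-cong shift-P (λ _ → K.refl) r) ⟩
        (c K.- 0# K.* d) K.* geometric c⁻¹ d (suc r) K.+ (constant (K.- d) ⊛ geometric c⁻¹ d) r
          ≈⟨ K.+-congˡ (constant-⊛ (K.- d) (geometric c⁻¹ d) r) ⟩
        (c K.- 0# K.* d) K.* (d K.* d ^ᴷ r K.* (c⁻¹ K.* c⁻¹ ^ᴷ suc r)) K.+ K.- d K.* geometric c⁻¹ d r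
          ≈⟨ KS.solve 5 (λ c c⁻¹ d dʳ c⁻ʳ →
               (c KS.:- KS.con 0ℤ KS.:* d) KS.:* (d KS.:* dʳ KS.:* (c⁻¹ KS.:* c⁻ʳ)) KS.:+ KS.:- d KS.:* (dʳ KS.:* c⁻ʳ)
               KS.:= (c KS.:* c⁻¹ KS.:- KS.:1) KS.:* (d KS.:* dʳ KS.:* c⁻ʳ))
               K.refl c c⁻¹ d (d ^ᴷ r) (c⁻¹ ^ᴷ suc r) ⟩
        (c K.* c⁻¹ K.- 1#) K.* (d K.* d ^ᴷ r K.* c⁻¹ ^ᴷ suc r)
          ≈⟨ K.*-congʳ (K.trans (K.+-congʳ cc⁻¹≈1) (K.-‿inverseʳ 1#)) ⟩
        0# K.* (d K.* d ^ᴷ r K.* c⁻¹ ^ᴷ suc r) ≈⟨ K.zeroˡ _ ⟩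
        0#        ∎
    }
    where
    open ≈ᴷ
    P = constant c - 𝐗 ⊛ constant d
    shift-P : ∀ n → shift P n ≈ constant (K.- d) n
    shift-P zero    = K.trans (K.+-congˡ (K.-‿cong (𝐗-⊛-suc (constant d) 0))) (K.+-identityˡ _)
    shift-P (suc n) = K.trans (K.+-congˡ (K.-‿cong (𝐗-⊛-suc (constant d) (suc n))))
                              (K.trans (K.+-identityˡ _) ε⁻¹≈ε)

module ℤ[[x]] = PowerSeries Data.Integer.Properties.+-*-commutativeRing
module ℤ[[x,y]] = PowerSeries ℤ[[x]].powerSeriesRing

module WordSums where

  open import Defs using (Step; U; D; words)
  open import Data.Nat using (ℕ; zero; suc; _+_; _*_; _∸_; _≤_; z≤n)
  import Data.Nat.Properties as ℕ
  open import Data.List using (List; []; _∷_; _++_; map)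
  open import Relation.Binary.PropositionalEquality
  open ≡-Reasoning
  open import Algebra.Properties.CommutativeSemigroup ℕ.+-commutativeSemigroup using (interchange)

  sumList : {A : Set} → (A → ℕ) → List A → ℕ
  sumList F []       = 0
  sumList F (x ∷ xs) = F x + sumList F xs

  module _ {A : Set} where

    sumList-++ : ∀ (F : A → ℕ) xs ys → sumList F (xs ++ ys) ≡ sumList F xs + sumList F ys
    sumList-++ F []       ys = refl
    sumList-++ F (x ∷ xs) ys = trans (cong (F x +_) (sumList-++ F xs ys)) (sym (ℕ.+-assoc (F x) _ _))

    sumList-map : ∀ {B : Set} (F : B → ℕ) (g : A → B) xs → sumList F (map g xs) ≡ sumList (λ x → F (g x)) xs
    sumList-map F g []       = refl
    sumList-map F g (x ∷ xs) = cong (F (g x) +_) (sumList-map F g xs)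

    sumList-cong : ∀ {F G : A → ℕ} xs → (∀ x → F x ≡ G x) → sumList F xs ≡ sumList G xs
    sumList-cong []       p = refl
    sumList-cong (x ∷ xs) p = cong₂ _+_ (p x) (sumList-cong xs p)

    sumList-+ : ∀ (F G : A → ℕ) xs → sumList (λ x → F x + G x) xs ≡ sumList F xs + sumList G xs
    sumList-+ F G []       = refl
    sumList-+ F G (x ∷ xs) = trans (cong (F x + G x +_) (sumList-+ F G xs)) (interchange (F x) (G x) _ _)

    sumList-*ˡ : ∀ c (F : A → ℕ) xs → sumList (λ x → c * F x) xs ≡ c * sumList F xs
    sumList-*ˡ c F []       = sym (ℕ.*-zeroʳ c)
    sumList-*ˡ c F (x ∷ xs) = trans (cong (c * F x +_) (sumList-*ˡ c F xs)) (sym (ℕ.*-distribˡ-+ c (F x) _))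

    sumList-*ʳ : ∀ c (F : A → ℕ) xs → sumList (λ x → F x * c) xs ≡ sumList F xs * c
    sumList-*ʳ c F xs = trans (sumList-cong xs (λ x → ℕ.*-comm (F x) c)) (trans (sumList-*ˡ c F xs) (ℕ.*-comm c _))

    sumList-zero : ∀ (F : A → ℕ) xs → (∀ x → F x ≡ 0) → sumList F xs ≡ 0
    sumList-zero F []       p = refl
    sumList-zero F (x ∷ xs) p = cong₂ _+_ (p x) (sumList-zero F xs p)

  Σ≤ℕ : ℕ → (ℕ → ℕ) → ℕ
  Σ≤ℕ zero    F = F 0
  Σ≤ℕ (suc n) F = Σ≤ℕ n F + F (suc n)

  Σ≤ℕ-cong : ∀ n {F G} → (∀ i → i ≤ n → F i ≡ G i) → Σ≤ℕ n F ≡ Σ≤ℕ n G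
  Σ≤ℕ-cong zero    p = p 0 z≤n
  Σ≤ℕ-cong (suc n) p = cong₂ _+_ (Σ≤ℕ-cong n (λ i i≤n → p i (ℕ.m≤n⇒m≤1+n i≤n))) (p (suc n) ℕ.≤-refl)

  Σ≤ℕ-suc : ∀ n F → Σ≤ℕ (suc n) F ≡ F 0 + Σ≤ℕ n (λ i → F (suc i))
  Σ≤ℕ-suc zero    F = refl
  Σ≤ℕ-suc (suc n) F = trans (cong (_+ F (suc (suc n))) (Σ≤ℕ-suc n F)) (ℕ.+-assoc (F 0) _ _)

  Σ≤ℕ-+ : ∀ n F G → Σ≤ℕ n (λ i → F i + G i) ≡ Σ≤ℕ n F + Σ≤ℕ n G
  Σ≤ℕ-+ zero    F G = refl
  Σ≤ℕ-+ (suc n) F G = trans (cong (_+ (F (suc n) + G (suc n))) (Σ≤ℕ-+ n F G))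
                            (interchange (Σ≤ℕ n F) (Σ≤ℕ n G) (F (suc n)) (G (suc n)))

  Σ≤ℕ-*ˡ : ∀ c n F → Σ≤ℕ n (λ i → c * F i) ≡ c * Σ≤ℕ n F
  Σ≤ℕ-*ˡ c zero    F = refl
  Σ≤ℕ-*ˡ c (suc n) F = trans (cong (_+ c * F (suc n)) (Σ≤ℕ-*ˡ c n F)) (sym (ℕ.*-distribˡ-+ c _ _))

  Σ≤ℕ-zero : ∀ n F → (∀ i → F i ≡ 0) → Σ≤ℕ n F ≡ 0
  Σ≤ℕ-zero zero    F p = p 0
  Σ≤ℕ-zero (suc n) F p = cong₂ _+_ (Σ≤ℕ-zero n F p) (p (suc n))

  Σ≤ℕ-comm : ∀ m n (G : ℕ → ℕ → ℕ) → Σ≤ℕ m (λ i → Σ≤ℕ n (G i)) ≡ Σ≤ℕ n (λ j → Σ≤ℕ m (λ i → G i j))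
  Σ≤ℕ-comm zero    n G = refl
  Σ≤ℕ-comm (suc m) n G = trans (cong (_+ Σ≤ℕ n (G (suc m))) (Σ≤ℕ-comm m n G))
                               (sym (Σ≤ℕ-+ n (λ j → Σ≤ℕ m (λ i → G i j)) (G (suc m))))

  sumList-Σ≤ℕ : ∀ {A : Set} (xs : List A) n (F : A → ℕ → ℕ) →
                sumList (λ x → Σ≤ℕ n (F x)) xs ≡ Σ≤ℕ n (λ i → sumList (λ x → F x i) xs)
  sumList-Σ≤ℕ xs zero    F = refl
  sumList-Σ≤ℕ xs (suc n) F = trans (sumList-+ (λ x → Σ≤ℕ n (F x)) (λ x → F x (suc n)) xs)
                                   (cong (_+ sumList (λ x → F x (suc n)) xs) (sumList-Σ≤ℕ xs n F))

  sumWords : ℕ → (List Step → ℕ) → ℕ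
  sumWords m F = sumList F (words m)

  sumWords-suc : ∀ m F → sumWords (suc m) F ≡ sumWords m (λ w → F (U ∷ w)) + sumWords m (λ w → F (D ∷ w))
  sumWords-suc m F = trans (sumList-++ F (map (U ∷_) (words m)) (map (D ∷_) (words m)))
                           (cong₂ _+_ (sumList-map F (U ∷_) (words m)) (sumList-map F (D ∷_) (words m)))

  sumWords-cong : ∀ m {F G} → (∀ w → F w ≡ G w) → sumWords m F ≡ sumWords m G
  sumWords-cong m = sumList-cong (words m)

  sumWords-zero : ∀ m F → (∀ w → F w ≡ 0) → sumWords m F ≡ 0
  sumWords-zero m F = sumList-zero F (words m)

  sumSplits : (List Step → List Step → ℕ) → List Step → ℕ
  sumSplits F []      = F [] []
  sumSplits F (x ∷ w) = F [] (x ∷ w) + sumSplits (λ a b → F (x ∷ a) b) w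

  sumSplits-cong : ∀ {F G} w → (∀ a b → F a b ≡ G a b) → sumSplits F w ≡ sumSplits G w
  sumSplits-cong []      p = p [] []
  sumSplits-cong (x ∷ w) p = cong₂ _+_ (p [] (x ∷ w)) (sumSplits-cong w (λ a b → p (x ∷ a) b))

  sumSplits-zero : ∀ {F} w → (∀ a b → F a b ≡ 0) → sumSplits F w ≡ 0
  sumSplits-zero []      p = p [] []
  sumSplits-zero (x ∷ w) p = cong₂ _+_ (p [] (x ∷ w)) (sumSplits-zero w (λ a b → p (x ∷ a) b))

  sumWords-sumSplits : ∀ m F →
    sumWords m (sumSplits F) ≡ Σ≤ℕ m (λ i → sumWords i (λ a → sumWords (m ∸ i) (F a)))
  sumWords-sumSplits zero    F = sym (ℕ.+-identityʳ _)
  sumWords-sumSplits (suc m) F = begin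
    sumWords (suc m) (sumSplits F)
      ≡⟨ sumWords-suc m (sumSplits F) ⟩
    sumWords m (λ w → F [] (U ∷ w) + sumSplits FU w) + sumWords m (λ w → F [] (D ∷ w) + sumSplits FD w)
      ≡⟨ cong₂ _+_ (sumList-+ (λ w → F [] (U ∷ w)) (sumSplits FU) (words m))
                   (sumList-+ (λ w → F [] (D ∷ w)) (sumSplits FD) (words m)) ⟩
    (sumWords m (λ w → F [] (U ∷ w)) + sumWords m (sumSplits FU))
      + (sumWords m (λ w → F [] (D ∷ w)) + sumWords m (sumSplits FD))
      ≡⟨ interchange (sumWords m (λ w → F [] (U ∷ w))) (sumWords m (sumSplits FU)) _ _ ⟩
    (sumWords m (λ w → F [] (U ∷ w)) + sumWords m (λ w → F [] (D ∷ w)))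
      + (sumWords m (sumSplits FU) + sumWords m (sumSplits FD))
      ≡⟨ cong₂ _+_ (sym (sumWords-suc m (F []))) (cong₂ _+_ (sumWords-sumSplits m FU) (sumWords-sumSplits m FD)) ⟩
    sumWords (suc m) (F []) + (Σ≤ℕ m (λ i → sumWords i (λ a → sumWords (m ∸ i) (FU a)))
                               + Σ≤ℕ m (λ i → sumWords i (λ a → sumWords (m ∸ i) (FD a))))
      ≡⟨ cong₂ _+_ (sym (ℕ.+-identityʳ _)) (sym (Σ≤ℕ-+ m _ _)) ⟩
    sumWords 0 (λ a → sumWords (suc m) (F a))
      + Σ≤ℕ m (λ i → sumWords i (λ a → sumWords (m ∸ i) (FU a)) + sumWords i (λ a → sumWords (m ∸ i) (FD a)))
      ≡⟨ cong (sumWords 0 (λ a → sumWords (suc m) (F a)) +_)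
              (Σ≤ℕ-cong m (λ i _ → sym (sumWords-suc i (λ a → sumWords (m ∸ i) (F a))))) ⟩
    sumWords 0 (λ a → sumWords (suc m) (F a)) + Σ≤ℕ m (λ i → sumWords (suc i) (λ a → sumWords (m ∸ i) (F a)))
      ≡⟨ Σ≤ℕ-suc m (λ i → sumWords i (λ a → sumWords (suc m ∸ i) (F a))) ⟨
    Σ≤ℕ (suc m) (λ i → sumWords i (λ a → sumWords (suc m ∸ i) (F a))) ∎
    where
    FU = λ a b → F (U ∷ a) b
    FD = λ a b → F (D ∷ a) b

module PathDecomposition where

  open import Defs using (Step; U; D; dyckFrom; valleysFrom)
  open WordSums
  open import Data.Bool using (Bool; true; false; if_then_else_; not)
  open import Data.Bool.Properties using (not-involutive)
  open import Data.Nat using (ℕ; zero; suc; _+_; _*_; _∸_; _≤_; _≡ᵇ_)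
  import Data.Nat.Properties as ℕ
  open import Data.List using (List; []; _∷_; _++_)
  open import Relation.Binary.PropositionalEquality
  open ≡-Reasoning

  χ : Bool → ℕ
  χ b = if b then 1 else 0

  dyckFrom-U∷ : ∀ h a → dyckFrom h (U ∷ a) ≡ dyckFrom (suc h) a
  dyckFrom-U∷ zero    a = refl
  dyckFrom-U∷ (suc h) a = refl

  afterDescent : ℕ → (List Step → ℕ) → List Step → List Step → ℕ
  afterDescent h g a []      = 0
  afterDescent h g a (U ∷ b) = 0
  afterDescent h g a (D ∷ b) = χ (dyckFrom h b) * g (a ++ D ∷ b)

  -- A path from height d + 1 + h to 0 splits uniquely at its first descent to height h.
  firstDescent : ∀ w d h (g : List Step → ℕ) →
    χ (dyckFrom (suc (d + h)) w) * g w ≡ sumSplits (λ a c → χ (dyckFrom d a) * afterDescent h g a c) w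
  firstDescent []      d       h g = sym (ℕ.*-zeroʳ (χ (dyckFrom d [])))
  firstDescent (U ∷ w) d       h g = begin
    χ (dyckFrom (suc (suc (d + h))) w) * g (U ∷ w)
      ≡⟨ firstDescent w (suc d) h (λ v → g (U ∷ v)) ⟩
    sumSplits (λ a c → χ (dyckFrom (suc d) a) * afterDescent h (λ v → g (U ∷ v)) a c) w
      ≡⟨ sumSplits-cong w (λ a c → cong₂ _*_ (cong χ (sym (dyckFrom-U∷ d a))) (afterDescent-U∷ a c)) ⟩
    sumSplits (λ a c → χ (dyckFrom d (U ∷ a)) * afterDescent h g (U ∷ a) c) w
      ≡⟨ cong (_+ sumSplits (λ a c → χ (dyckFrom d (U ∷ a)) * afterDescent h g (U ∷ a) c) w)
              (ℕ.*-zeroʳ (χ (dyckFrom d []))) ⟨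
    sumSplits (λ a c → χ (dyckFrom d a) * afterDescent h g a c) (U ∷ w) ∎
    where
    afterDescent-U∷ : ∀ a c → afterDescent h (λ v → g (U ∷ v)) a c ≡ afterDescent h g (U ∷ a) c
    afterDescent-U∷ a []      = refl
    afterDescent-U∷ a (U ∷ c) = refl
    afterDescent-U∷ a (D ∷ c) = refl
  firstDescent (D ∷ w) zero    h g = begin
    χ (dyckFrom h w) * g (D ∷ w)              ≡⟨ ℕ.+-identityʳ _ ⟨
    χ (dyckFrom h w) * g (D ∷ w) + 0          ≡⟨ cong₂ _+_ (ℕ.+-identityʳ _) (sumSplits-zero w (λ a b → refl)) ⟨
    sumSplits (λ a c → χ (dyckFrom zero a) * afterDescent h g a c) (D ∷ w) ∎
  firstDescent (D ∷ w) (suc d) h g = begin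
    χ (dyckFrom (suc (d + h)) w) * g (D ∷ w)
      ≡⟨ firstDescent w d h (λ v → g (D ∷ v)) ⟩
    sumSplits (λ a c → χ (dyckFrom d a) * afterDescent h (λ v → g (D ∷ v)) a c) w
      ≡⟨ sumSplits-cong w (λ a c → cong (χ (dyckFrom d a) *_) (afterDescent-D∷ a c)) ⟩
    sumSplits (λ a c → χ (dyckFrom (suc d) (D ∷ a)) * afterDescent h g (D ∷ a) c) w ∎
    where
    afterDescent-D∷ : ∀ a c → afterDescent h (λ v → g (D ∷ v)) a c ≡ afterDescent h g (D ∷ a) c
    afterDescent-D∷ a []      = refl
    afterDescent-D∷ a (U ∷ c) = refl
    afterDescent-D∷ a (D ∷ c) = refl

  sumWords-firstDescent : ∀ m h (g : List Step → ℕ) →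
    sumWords (suc m) (λ w → χ (dyckFrom (suc h) w) * g w)
      ≡ Σ≤ℕ m (λ i → sumWords i (λ a → sumWords (m ∸ i) (λ b →
          χ (dyckFrom 0 a) * (χ (dyckFrom h b) * g (a ++ D ∷ b)))))
  sumWords-firstDescent m h g = begin
    sumWords (suc m) (λ w → χ (dyckFrom (suc h) w) * g w)
      ≡⟨ sumWords-cong (suc m) (λ w → firstDescent w 0 h g) ⟩
    sumWords (suc m) (sumSplits F)
      ≡⟨ sumWords-sumSplits (suc m) F ⟩
    Σ≤ℕ m (λ i → sumWords i (λ a → sumWords (suc m ∸ i) (F a))) + sumWords (suc m) (λ a → sumWords (m ∸ m) (F a))
      ≡⟨ cong₂ _+_ (Σ≤ℕ-cong m (λ i i≤m → sumWords-cong i (λ a → descentFirst i i≤m a)))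
                   (sumWords-zero (suc m) _ (λ a → trans (cong (λ k → sumWords k (F a)) (ℕ.n∸n≡0 m))
                                                         (cong (_+ 0) (ℕ.*-zeroʳ (χ (dyckFrom 0 a)))))) ⟩
    Σ≤ℕ m (λ i → sumWords i (λ a → sumWords (m ∸ i) (λ b → χ (dyckFrom 0 a) * (χ (dyckFrom h b) * g (a ++ D ∷ b))))) + 0
      ≡⟨ ℕ.+-identityʳ _ ⟩
    _ ∎
    where
    F = λ a c → χ (dyckFrom 0 a) * afterDescent h g a c
    descentFirst : ∀ i → i ≤ m → ∀ a → sumWords (suc m ∸ i) (F a)
                 ≡ sumWords (m ∸ i) (λ b → χ (dyckFrom 0 a) * (χ (dyckFrom h b) * g (a ++ D ∷ b)))
    descentFirst i i≤m a = begin
      sumWords (suc m ∸ i) (F a)       ≡⟨ cong (λ k → sumWords k (F a)) (ℕ.+-∸-assoc 1 i≤m) ⟩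
      sumWords (suc (m ∸ i)) (F a)     ≡⟨ sumWords-suc (m ∸ i) (F a) ⟩
      sumWords (m ∸ i) (λ b → F a (U ∷ b)) + sumWords (m ∸ i) (λ b → F a (D ∷ b))
        ≡⟨ cong (_+ sumWords (m ∸ i) (λ b → F a (D ∷ b)))
                (sumWords-zero (m ∸ i) _ (λ b → ℕ.*-zeroʳ (χ (dyckFrom 0 a)))) ⟩
      sumWords (m ∸ i) (λ b → F a (D ∷ b)) ∎

  sumWords-firstReturn : ∀ m (g : List Step → ℕ) →
    sumWords (suc (suc m)) (λ w → χ (dyckFrom 0 w) * g w)
      ≡ Σ≤ℕ m (λ i → sumWords i (λ a → sumWords (m ∸ i) (λ b →
          χ (dyckFrom 0 a) * (χ (dyckFrom 0 b) * g (U ∷ a ++ D ∷ b)))))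
  sumWords-firstReturn m g = begin
    sumWords (suc (suc m)) (λ w → χ (dyckFrom 0 w) * g w)
      ≡⟨ sumWords-suc (suc m) _ ⟩
    sumWords (suc m) (λ w → χ (dyckFrom 1 w) * g (U ∷ w)) + sumWords (suc m) (λ w → 0)
      ≡⟨ cong₂ _+_ (sumWords-firstDescent m 0 (λ w → g (U ∷ w))) (sumWords-zero (suc m) _ (λ _ → refl)) ⟩
    _ + 0 ≡⟨ ℕ.+-identityʳ _ ⟩
    _ ∎

  junctionValley : ℕ → ℕ → List Step → ℕ
  junctionValley k h []      = 0
  junctionValley k h (U ∷ s) = χ (h ≡ᵇ k)
  junctionValley k h (D ∷ s) = 0

  valleysFrom-D∷ : ∀ k h s → valleysFrom k (suc h) (D ∷ s) ≡ junctionValley k h s + valleysFrom k h s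
  valleysFrom-D∷ k h []      = refl
  valleysFrom-D∷ k h (U ∷ s) = refl
  valleysFrom-D∷ k h (D ∷ s) = refl

  valleysFrom-++ : ∀ k d h a b → dyckFrom d a ≡ true →
    valleysFrom k (d + h) (a ++ D ∷ b) ≡ valleysFrom k (d + h) a + valleysFrom k h (D ∷ b)
  valleysFrom-++ k zero    h []      b p  = refl
  valleysFrom-++ k (suc d) h []      b ()
  valleysFrom-++ k d       h (U ∷ a) b p  = valleysFrom-++ k (suc d) h a b (trans (sym (dyckFrom-U∷ d a)) p)
  valleysFrom-++ k zero    h (D ∷ a) b ()
  valleysFrom-++ k (suc d) h (D ∷ a) b p  = begin
    valleysFrom k (suc (d + h)) (D ∷ (a ++ D ∷ b))
      ≡⟨ valleysFrom-D∷ k (d + h) (a ++ D ∷ b) ⟩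
    junctionValley k (d + h) (a ++ D ∷ b) + valleysFrom k (d + h) (a ++ D ∷ b)
      ≡⟨ cong₂ _+_ (junction-++ a) (valleysFrom-++ k d h a b p) ⟩
    junctionValley k (d + h) a + (valleysFrom k (d + h) a + valleysFrom k h (D ∷ b))
      ≡⟨ ℕ.+-assoc (junctionValley k (d + h) a) _ _ ⟨
    (junctionValley k (d + h) a + valleysFrom k (d + h) a) + valleysFrom k h (D ∷ b)
      ≡⟨ cong (_+ valleysFrom k h (D ∷ b)) (valleysFrom-D∷ k (d + h) a) ⟨
    valleysFrom k (suc (d + h)) (D ∷ a) + valleysFrom k h (D ∷ b) ∎
    where
    junction-++ : ∀ a → junctionValley k (d + h) (a ++ D ∷ b) ≡ junctionValley k (d + h) a
    junction-++ []      = refl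
    junction-++ (U ∷ a) = refl
    junction-++ (D ∷ a) = refl

  valleysFrom-lift : ∀ k d h a → dyckFrom d a ≡ true →
    valleysFrom (suc k) (suc (d + h)) a ≡ valleysFrom k (d + h) a
  valleysFrom-lift k zero    h []      p  = refl
  valleysFrom-lift k (suc d) h []      ()
  valleysFrom-lift k d       h (U ∷ a) p  = valleysFrom-lift k (suc d) h a (trans (sym (dyckFrom-U∷ d a)) p)
  valleysFrom-lift k zero    h (D ∷ a) ()
  valleysFrom-lift k (suc d) h (D ∷ a) p  = begin
    valleysFrom (suc k) (suc (suc (d + h))) (D ∷ a)
      ≡⟨ valleysFrom-D∷ (suc k) (suc (d + h)) a ⟩
    junctionValley (suc k) (suc (d + h)) a + valleysFrom (suc k) (suc (d + h)) a
      ≡⟨ cong₂ _+_ (junction-lift a) (valleysFrom-lift k d h a p) ⟩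
    junctionValley k (d + h) a + valleysFrom k (d + h) a
      ≡⟨ valleysFrom-D∷ k (d + h) a ⟨
    valleysFrom k (suc (d + h)) (D ∷ a) ∎
    where
    junction-lift : ∀ a → junctionValley (suc k) (suc (d + h)) a ≡ junctionValley k (d + h) a
    junction-lift []      = refl
    junction-lift (U ∷ a) = refl
    junction-lift (D ∷ a) = refl

  valleysFrom-lift-ground : ∀ d h a → dyckFrom d a ≡ true → valleysFrom 0 (suc (d + h)) a ≡ 0
  valleysFrom-lift-ground zero    h []      p  = refl
  valleysFrom-lift-ground (suc d) h []      ()
  valleysFrom-lift-ground d       h (U ∷ a) p  = valleysFrom-lift-ground (suc d) h a (trans (sym (dyckFrom-U∷ d a)) p)
  valleysFrom-lift-ground zero    h (D ∷ a) ()
  valleysFrom-lift-ground (suc d) h (D ∷ a) p  =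
    trans (valleysFrom-D∷ 0 (suc (d + h)) a) (cong₂ _+_ (junction-ground a) (valleysFrom-lift-ground d h a p))
    where
    junction-ground : ∀ a → junctionValley 0 (suc (d + h)) a ≡ 0
    junction-ground []      = refl
    junction-ground (U ∷ a) = refl
    junction-ground (D ∷ a) = refl

  isEven : ℕ → Bool
  isEven zero    = true
  isEven (suc n) = not (isEven n)

  isEven-double : ∀ n → isEven (2 * n) ≡ true
  isEven-double zero    = refl
  isEven-double (suc n) = begin
    isEven (2 * suc n)            ≡⟨ cong isEven (ℕ.*-suc 2 n) ⟩
    not (not (isEven (2 * n)))    ≡⟨ not-involutive (isEven (2 * n)) ⟩
    isEven (2 * n)                ≡⟨ isEven-double n ⟩
    true                          ∎

  -- A path of length m from height h can only end at height 0 if m + h is even.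
  sumWords-dyckFrom-odd : ∀ m h H → isEven (m + h) ≡ false → sumWords m (λ a → χ (dyckFrom h a) * H a) ≡ 0
  sumWords-dyckFrom-odd zero    zero    H ()
  sumWords-dyckFrom-odd zero    (suc h) H p = refl
  sumWords-dyckFrom-odd (suc m) h       H p = begin
    sumWords (suc m) (λ a → χ (dyckFrom h a) * H a)
      ≡⟨ sumWords-suc m _ ⟩
    sumWords m (λ a → χ (dyckFrom h (U ∷ a)) * H (U ∷ a)) + sumWords m (λ a → χ (dyckFrom h (D ∷ a)) * H (D ∷ a))
      ≡⟨ cong (_+ sumWords m (λ a → χ (dyckFrom h (D ∷ a)) * H (D ∷ a)))
              (sumWords-cong m (λ a → cong (λ b → χ b * H (U ∷ a)) (dyckFrom-U∷ h a))) ⟩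
    sumWords m (λ a → χ (dyckFrom (suc h) a) * H (U ∷ a)) + sumWords m (λ a → χ (dyckFrom h (D ∷ a)) * H (D ∷ a))
      ≡⟨ cong₂ _+_ (sumWords-dyckFrom-odd m (suc h) (λ a → H (U ∷ a)) (trans (cong isEven (ℕ.+-suc m h)) p))
                   (afterDown h p) ⟩
    0 ∎
    where
    afterDown : ∀ h → isEven (suc m + h) ≡ false → sumWords m (λ a → χ (dyckFrom h (D ∷ a)) * H (D ∷ a)) ≡ 0
    afterDown zero    q = sumWords-zero m _ (λ _ → refl)
    afterDown (suc h) q = sumWords-dyckFrom-odd m h (λ a → H (D ∷ a))
      (trans (sym (not-involutive (isEven (m + h)))) (trans (cong (λ k → not (isEven k)) (sym (ℕ.+-suc m h))) q))

  Σ≤ℕ-double : ∀ n F → (∀ i → isEven i ≡ false → F i ≡ 0) → Σ≤ℕ (2 * n) F ≡ Σ≤ℕ n (λ i → F (2 * i))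
  Σ≤ℕ-double zero    F p = refl
  Σ≤ℕ-double (suc n) F p = begin
    Σ≤ℕ (2 * suc n) F                                ≡⟨ cong (λ k → Σ≤ℕ k F) (ℕ.*-suc 2 n) ⟩
    Σ≤ℕ (2 * n) F + F (suc (2 * n)) + F (suc (suc (2 * n)))
      ≡⟨ cong₂ _+_ (cong₂ _+_ (Σ≤ℕ-double n F p) (p (suc (2 * n)) (cong not (isEven-double n))))
                   (cong F (sym (ℕ.*-suc 2 n))) ⟩
    Σ≤ℕ n (λ i → F (2 * i)) + 0 + F (2 * suc n)      ≡⟨ cong (_+ F (2 * suc n)) (ℕ.+-identityʳ _) ⟩
    Σ≤ℕ (suc n) (λ i → F (2 * i))                    ∎

module ValleyCounts where

  open import Defs using (Step; U; D; words; isDyck; valleysFrom; valleys; valley; countTrue)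
  open WordSums
  open PathDecomposition
  open import Data.Bool using (Bool; true; false; _∧_)
  open import Data.Nat using (ℕ; zero; suc; _+_; _*_; _∸_; _≡ᵇ_)
  import Data.Nat.Properties as ℕ
  open import Data.List using (List; []; _∷_; _++_)
  open import Relation.Binary.PropositionalEquality
  open ≡-Reasoning

  -- Valleys at height ℓ of U a D b contributed by a, resp. by D b.
  liftedValleys : ℕ → List Step → ℕ
  liftedValleys zero    a = 0
  liftedValleys (suc ℓ) a = valleys ℓ a

  returnValleys : ℕ → List Step → ℕ
  returnValleys ℓ b = junctionValley ℓ 0 b + valleys ℓ b

  liftedCount returnCount : ℕ → ℕ → ℕ → ℕ
  liftedCount ℓ r i = sumWords (2 * i) (λ a → χ (isDyck a) * χ (liftedValleys ℓ a ≡ᵇ r))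
  returnCount ℓ r j = sumWords (2 * j) (λ b → χ (isDyck b) * χ (returnValleys ℓ b ≡ᵇ r))

  dyckCount : ℕ → ℕ
  dyckCount i = sumWords (2 * i) (λ a → χ (isDyck a))

  χ-∧ : ∀ a b → χ (a ∧ b) ≡ χ a * χ b
  χ-∧ true  b = sym (ℕ.+-identityʳ (χ b))
  χ-∧ false b = refl

  χ-sumList : ∀ {A : Set} (p : A → Bool) xs → countTrue p xs ≡ sumList (λ x → χ (p x)) xs
  χ-sumList p []       = refl
  χ-sumList p (x ∷ xs) = cong (χ (p x) +_) (χ-sumList p xs)

  valley-sumWords : ∀ ℓ r n → valley ℓ r n ≡ sumWords (2 * n) (λ w → χ (isDyck w) * χ (valleys ℓ w ≡ᵇ r))
  valley-sumWords ℓ r n = trans (χ-sumList _ (words (2 * n))) (sumWords-cong (2 * n) (λ w → χ-∧ (isDyck w) _))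

  valley-zero : ∀ ℓ r → valley ℓ r 0 ≡ χ (0 ≡ᵇ r)
  valley-zero ℓ r = ℕ.+-identityʳ _

  χ-+-≡ᵇ : ∀ r x y → χ (x + y ≡ᵇ r) ≡ Σ≤ℕ r (λ s → χ (x ≡ᵇ s) * χ (y ≡ᵇ r ∸ s))
  χ-+-≡ᵇ zero    zero    y = sym (ℕ.+-identityʳ _)
  χ-+-≡ᵇ zero    (suc x) y = refl
  χ-+-≡ᵇ (suc r) x       y = trans (split x) (sym (Σ≤ℕ-suc r (λ s → χ (x ≡ᵇ s) * χ (y ≡ᵇ suc r ∸ s))))
    where
    split : ∀ x → χ (x + y ≡ᵇ suc r)
                ≡ χ (x ≡ᵇ 0) * χ (y ≡ᵇ suc r) + Σ≤ℕ r (λ s → χ (x ≡ᵇ suc s) * χ (y ≡ᵇ r ∸ s))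
    split zero    = sym (trans (cong₂ _+_ (ℕ.+-identityʳ _) (Σ≤ℕ-zero r _ (λ _ → refl))) (ℕ.+-identityʳ _))
    split (suc x) = χ-+-≡ᵇ r x y

  valleys-firstReturn : ∀ ℓ a b → isDyck a ≡ true →
    valleys ℓ (U ∷ a ++ D ∷ b) ≡ liftedValleys ℓ a + returnValleys ℓ b
  valleys-firstReturn ℓ a b a-dyck =
    trans (valleysFrom-++ ℓ 0 1 a b a-dyck) (cong₂ _+_ (lifted ℓ) (valleysFrom-D∷ ℓ 0 b))
    where
    lifted : ∀ ℓ → valleysFrom ℓ 1 a ≡ liftedValleys ℓ a
    lifted zero    = valleysFrom-lift-ground 0 0 a a-dyck
    lifted (suc ℓ) = valleysFrom-lift ℓ 0 0 a a-dyck

  weighted-firstReturn : ∀ ℓ r a b →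
    χ (isDyck a) * (χ (isDyck b) * χ (valleys ℓ (U ∷ a ++ D ∷ b) ≡ᵇ r))
      ≡ χ (isDyck a) * (χ (isDyck b) * χ (liftedValleys ℓ a + returnValleys ℓ b ≡ᵇ r))
  weighted-firstReturn ℓ r a b with isDyck a in a-dyck
  ... | false = refl
  ... | true  = cong (λ v → 1 * (χ (isDyck b) * χ (v ≡ᵇ r))) (valleys-firstReturn ℓ a b a-dyck)

  sumWords-product : ∀ ℓ r p q →
    sumWords p (λ a → sumWords q (λ b → χ (isDyck a) * (χ (isDyck b) * χ (liftedValleys ℓ a + returnValleys ℓ b ≡ᵇ r))))
      ≡ Σ≤ℕ r (λ s → sumWords p (λ a → χ (isDyck a) * χ (liftedValleys ℓ a ≡ᵇ s))
                   * sumWords q (λ b → χ (isDyck b) * χ (returnValleys ℓ b ≡ᵇ r ∸ s)))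
  sumWords-product ℓ r p q = begin
    sumWords p (λ a → sumWords q (λ b → χ (isDyck a) * (χ (isDyck b) * χ (liftedValleys ℓ a + returnValleys ℓ b ≡ᵇ r))))
      ≡⟨ sumWords-cong p (λ a → sumWords-cong q (λ b → split a b)) ⟩
    sumWords p (λ a → sumWords q (λ b → Σ≤ℕ r (λ s → A a s * B b s)))
      ≡⟨ sumWords-cong p (λ a → sumList-Σ≤ℕ (words q) r (λ b s → A a s * B b s)) ⟩
    sumWords p (λ a → Σ≤ℕ r (λ s → sumWords q (λ b → A a s * B b s)))
      ≡⟨ sumWords-cong p (λ a → Σ≤ℕ-cong r (λ s _ → sumList-*ˡ (A a s) (λ b → B b s) (words q))) ⟩
    sumWords p (λ a → Σ≤ℕ r (λ s → A a s * sumWords q (λ b → B b s)))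
      ≡⟨ sumList-Σ≤ℕ (words p) r (λ a s → A a s * sumWords q (λ b → B b s)) ⟩
    Σ≤ℕ r (λ s → sumWords p (λ a → A a s * sumWords q (λ b → B b s)))
      ≡⟨ Σ≤ℕ-cong r (λ s _ → sumList-*ʳ (sumWords q (λ b → B b s)) (λ a → A a s) (words p)) ⟩
    Σ≤ℕ r (λ s → sumWords p (λ a → A a s) * sumWords q (λ b → B b s)) ∎
    where
    A = λ a s → χ (isDyck a) * χ (liftedValleys ℓ a ≡ᵇ s)
    B = λ b s → χ (isDyck b) * χ (returnValleys ℓ b ≡ᵇ r ∸ s)
    split : ∀ a b → χ (isDyck a) * (χ (isDyck b) * χ (liftedValleys ℓ a + returnValleys ℓ b ≡ᵇ r))
                  ≡ Σ≤ℕ r (λ s → A a s * B b s)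
    split a b = begin
      χ (isDyck a) * (χ (isDyck b) * χ (liftedValleys ℓ a + returnValleys ℓ b ≡ᵇ r))
        ≡⟨ cong (λ v → χ (isDyck a) * (χ (isDyck b) * v)) (χ-+-≡ᵇ r (liftedValleys ℓ a) (returnValleys ℓ b)) ⟩
      χ (isDyck a) * (χ (isDyck b) * Σ≤ℕ r (λ s → χ (liftedValleys ℓ a ≡ᵇ s) * χ (returnValleys ℓ b ≡ᵇ r ∸ s)))
        ≡⟨ cong (χ (isDyck a) *_) (Σ≤ℕ-*ˡ (χ (isDyck b)) r _) ⟨
      χ (isDyck a) * Σ≤ℕ r (λ s → χ (isDyck b) * (χ (liftedValleys ℓ a ≡ᵇ s) * χ (returnValleys ℓ b ≡ᵇ r ∸ s)))
        ≡⟨ Σ≤ℕ-*ˡ (χ (isDyck a)) r _ ⟨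
      Σ≤ℕ r (λ s → χ (isDyck a) * (χ (isDyck b) * (χ (liftedValleys ℓ a ≡ᵇ s) * χ (returnValleys ℓ b ≡ᵇ r ∸ s))))
        ≡⟨ Σ≤ℕ-cong r (λ s _ → x[y[uv]]≡[xu][yv] (χ (isDyck a)) (χ (isDyck b)) _ _) ⟩
      Σ≤ℕ r (λ s → A a s * B b s) ∎
      where
      open import Data.Nat.Solver using (module +-*-Solver)
      open +-*-Solver using (solve; _:=_; _:*_)
      x[y[uv]]≡[xu][yv] : ∀ x y u v → x * (y * (u * v)) ≡ (x * u) * (y * v)
      x[y[uv]]≡[xu][yv] = solve 4 (λ x y u v → x :* (y :* (u :* v)) := (x :* u) :* (y :* v)) refl

  valley-suc : ∀ ℓ r n →
    valley ℓ r (suc n) ≡ Σ≤ℕ n (λ i → Σ≤ℕ r (λ s → liftedCount ℓ s i * returnCount ℓ (r ∸ s) (n ∸ i)))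
  valley-suc ℓ r n = begin
    valley ℓ r (suc n)
      ≡⟨ valley-sumWords ℓ r (suc n) ⟩
    sumWords (2 * suc n) (λ w → χ (isDyck w) * g w)
      ≡⟨ cong (λ m → sumWords m (λ w → χ (isDyck w) * g w)) (ℕ.*-suc 2 n) ⟩
    sumWords (suc (suc (2 * n))) (λ w → χ (isDyck w) * g w)
      ≡⟨ sumWords-firstReturn (2 * n) g ⟩
    Σ≤ℕ (2 * n) (λ i → sumWords i (λ a → sumWords (2 * n ∸ i) (λ b → weight a b)))
      ≡⟨ Σ≤ℕ-double n _ (λ i i-odd → trans (sumWords-cong i (λ a → sumList-*ˡ (χ (isDyck a)) _ (words (2 * n ∸ i))))
                                            (sumWords-dyckFrom-odd i 0 _ (trans (cong isEven (ℕ.+-identityʳ i)) i-odd))) ⟩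
    Σ≤ℕ n (λ i → sumWords (2 * i) (λ a → sumWords (2 * n ∸ 2 * i) (λ b → weight a b)))
      ≡⟨ Σ≤ℕ-cong n (λ i _ → cong (λ m → sumWords (2 * i) (λ a → sumWords m (λ b → weight a b)))
                                  (sym (ℕ.*-distribˡ-∸ 2 n i))) ⟩
    Σ≤ℕ n (λ i → sumWords (2 * i) (λ a → sumWords (2 * (n ∸ i)) (λ b → weight a b)))
      ≡⟨ Σ≤ℕ-cong n (λ i _ → sumWords-cong (2 * i) (λ a → sumWords-cong (2 * (n ∸ i)) (λ b → weighted-firstReturn ℓ r a b))) ⟩
    Σ≤ℕ n (λ i → sumWords (2 * i) (λ a → sumWords (2 * (n ∸ i)) (λ b →
      χ (isDyck a) * (χ (isDyck b) * χ (liftedValleys ℓ a + returnValleys ℓ b ≡ᵇ r)))))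
      ≡⟨ Σ≤ℕ-cong n (λ i _ → sumWords-product ℓ r (2 * i) (2 * (n ∸ i))) ⟩
    Σ≤ℕ n (λ i → Σ≤ℕ r (λ s → liftedCount ℓ s i * returnCount ℓ (r ∸ s) (n ∸ i))) ∎
    where
    g : List Step → ℕ
    g w = χ (valleys ℓ w ≡ᵇ r)
    weight : List Step → List Step → ℕ
    weight a b = χ (isDyck a) * (χ (isDyck b) * g (U ∷ a ++ D ∷ b))

  liftedCount-suc : ∀ ℓ r i → liftedCount (suc ℓ) r i ≡ valley ℓ r i
  liftedCount-suc ℓ r i = sym (valley-sumWords ℓ r i)

  liftedCount-zero : ∀ r i → liftedCount 0 r i ≡ χ (0 ≡ᵇ r) * dyckCount i
  liftedCount-zero r i = trans (sumWords-cong (2 * i) (λ a → ℕ.*-comm (χ (isDyck a)) _))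
                               (sumList-*ˡ (χ (0 ≡ᵇ r)) (λ a → χ (isDyck a)) (words (2 * i)))

  returnCount-suc : ∀ ℓ r j → returnCount (suc ℓ) r j ≡ valley (suc ℓ) r j
  returnCount-suc ℓ r j = trans
    (sumWords-cong (2 * j) (λ b → cong (λ v → χ (isDyck b) * χ (v + valleys (suc ℓ) b ≡ᵇ r)) (no-junction b)))
    (sym (valley-sumWords (suc ℓ) r j))
    where
    no-junction : ∀ b → junctionValley (suc ℓ) 0 b ≡ 0
    no-junction []      = refl
    no-junction (U ∷ b) = refl
    no-junction (D ∷ b) = refl

  -- At height 0, the junction between a and a nonempty b is one more valley.
  returnCount-zero-zero : ∀ j → returnCount 0 0 j ≡ χ (j ≡ᵇ 0)
  returnCount-zero-zero zero    = refl
  returnCount-zero-zero (suc j) = begin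
    returnCount 0 0 (suc j)
      ≡⟨ cong (λ m → sumWords m (λ b → χ (isDyck b) * χ (returnValleys 0 b ≡ᵇ 0))) (ℕ.*-suc 2 j) ⟩
    sumWords (suc (suc (2 * j))) (λ b → χ (isDyck b) * χ (returnValleys 0 b ≡ᵇ 0))
      ≡⟨ sumWords-suc (suc (2 * j)) _ ⟩
    sumWords (suc (2 * j)) (λ b → χ (isDyck (U ∷ b)) * 0) + sumWords (suc (2 * j)) (λ b → 0)
      ≡⟨ cong₂ _+_ (sumWords-zero (suc (2 * j)) _ (λ b → ℕ.*-zeroʳ (χ (isDyck (U ∷ b)))))
                   (sumWords-zero (suc (2 * j)) _ (λ _ → refl)) ⟩
    0 ∎

  returnCount-zero-suc : ∀ r j → returnCount 0 (suc r) j + χ (j ≡ᵇ 0) * χ (r ≡ᵇ 0) ≡ valley 0 r j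
  returnCount-zero-suc zero    zero    = refl
  returnCount-zero-suc (suc r) zero    = refl
  returnCount-zero-suc r       (suc j) = begin
    returnCount 0 (suc r) (suc j) + 0
      ≡⟨ ℕ.+-identityʳ _ ⟩
    returnCount 0 (suc r) (suc j)
      ≡⟨ cong (λ m → sumWords m (λ b → χ (isDyck b) * χ (returnValleys 0 b ≡ᵇ suc r))) (ℕ.*-suc 2 j) ⟩
    sumWords (suc (suc (2 * j))) (λ b → χ (isDyck b) * χ (returnValleys 0 b ≡ᵇ suc r))
      ≡⟨ sumWords-suc (suc (2 * j)) _ ⟩
    sumWords (suc (2 * j)) (λ b → χ (isDyck (U ∷ b)) * χ (valleys 0 (U ∷ b) ≡ᵇ r)) + sumWords (suc (2 * j)) (λ b → 0)
      ≡⟨ sumWords-suc (suc (2 * j)) _ ⟨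
    sumWords (suc (suc (2 * j))) (λ w → χ (isDyck w) * χ (valleys 0 w ≡ᵇ r))
      ≡⟨ cong (λ m → sumWords m (λ w → χ (isDyck w) * χ (valleys 0 w ≡ᵇ r))) (ℕ.*-suc 2 j) ⟨
    sumWords (2 * suc j) (λ w → χ (isDyck w) * χ (valleys 0 w ≡ᵇ r))
      ≡⟨ valley-sumWords 0 r (suc j) ⟨
    valley 0 r (suc j) ∎

module CatalanCount where

  open import Defs using (U; D; dyckFrom; catalan)
  open import Data.List using (_∷_)
  open WordSums
  open PathDecomposition
  open ValleyCounts using (dyckCount)
  open import Data.Nat using (ℕ; zero; suc; _+_; _*_; _<_; s≤s)
  import Data.Nat.Properties as ℕ
  open import Data.Nat.Combinatorics using (_C_; k>n⇒nCk≡0; nCk+nC[k+1]≡[n+1]C[k+1]; nC1≡n)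
  open import Data.Nat.DivMod using (_/_; m*n/n≡m)
  open import Data.Nat.Solver using (module +-*-Solver)
  open +-*-Solver using (solve; _:=_; _:+_; _:*_; con)
  open import Relation.Binary.PropositionalEquality
  open ≡-Reasoning

  ballotCount : ℕ → ℕ → ℕ
  ballotCount zero    zero    = 1
  ballotCount zero    (suc h) = 0
  ballotCount (suc m) zero    = ballotCount m 1
  ballotCount (suc m) (suc h) = ballotCount m (suc (suc h)) + ballotCount m h

  sumWords-ballotCount : ∀ m h → sumWords m (λ w → χ (dyckFrom h w)) ≡ ballotCount m h
  sumWords-ballotCount zero    zero    = refl
  sumWords-ballotCount zero    (suc h) = refl
  sumWords-ballotCount (suc m) h       = begin
    sumWords (suc m) (λ w → χ (dyckFrom h w))
      ≡⟨ sumWords-suc m _ ⟩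
    sumWords m (λ w → χ (dyckFrom h (U ∷ w))) + sumWords m (λ w → χ (dyckFrom h (D ∷ w)))
      ≡⟨ cong (_+ sumWords m (λ w → χ (dyckFrom h (D ∷ w))))
              (trans (sumWords-cong m (λ w → cong χ (dyckFrom-U∷ h w))) (sumWords-ballotCount m (suc h))) ⟩
    ballotCount m (suc h) + sumWords m (λ w → χ (dyckFrom h (D ∷ w)))
      ≡⟨ afterDown h ⟩
    ballotCount (suc m) h ∎
    where
    afterDown : ∀ h → ballotCount m (suc h) + sumWords m (λ w → χ (dyckFrom h (D ∷ w))) ≡ ballotCount (suc m) h
    afterDown zero    = trans (cong (ballotCount m 1 +_) (sumWords-zero m _ (λ _ → refl))) (ℕ.+-identityʳ _)
    afterDown (suc h) = cong (ballotCount m (suc (suc h)) +_) (sumWords-ballotCount m h)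

  ballotCount-tooHigh : ∀ m h → m < h → ballotCount m h ≡ 0
  ballotCount-tooHigh zero    (suc h) _         = refl
  ballotCount-tooHigh (suc m) (suc h) (s≤s m<h) =
    cong₂ _+_ (ballotCount-tooHigh m (suc (suc h)) (ℕ.m<n⇒m<1+n (ℕ.m<n⇒m<1+n m<h))) (ballotCount-tooHigh m h m<h)

  pascal : ∀ n k → suc n C suc k ≡ n C k + n C suc k
  pascal n k = sym (nCk+nC[k+1]≡[n+1]C[k+1] n k)

  -- Reflection principle: of the C(m, u) paths of length m = h + 2u from height h to 0,
  -- C(m, h + u + 1) go below 0.
  ballotCount+binomial : ∀ m h u → m ≡ h + (u + u) → ballotCount m h + m C suc (h + u) ≡ m C u
  ballotCount+binomial zero    zero    zero    refl = refl
  ballotCount+binomial (suc m) zero    (suc u) eq   = begin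
    ballotCount m 1 + suc m C suc (suc u)
      ≡⟨ cong (ballotCount m 1 +_) (pascal m (suc u)) ⟩
    ballotCount m 1 + (m C suc u + m C suc (suc u))
      ≡⟨ x+[y+z]≡y+[x+z] (ballotCount m 1) (m C suc u) (m C suc (suc u)) ⟩
    m C suc u + (ballotCount m 1 + m C suc (suc u))
      ≡⟨ cong (m C suc u +_) (ballotCount+binomial m 1 u (ℕ.suc-injective (trans eq (cong suc (ℕ.+-suc u u))))) ⟩
    m C suc u + m C u
      ≡⟨ trans (ℕ.+-comm (m C suc u) (m C u)) (sym (pascal m u)) ⟩
    suc m C suc u ∎
    where
    x+[y+z]≡y+[x+z] : ∀ x y z → x + (y + z) ≡ y + (x + z)
    x+[y+z]≡y+[x+z] = solve 3 (λ x y z → x :+ (y :+ z) := y :+ (x :+ z)) refl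
  ballotCount+binomial (suc m) (suc h) zero    eq   = begin
    ballotCount m (suc (suc h)) + ballotCount m h + suc m C suc (suc (h + 0))
      ≡⟨ cong₂ _+_ (cong (_+ ballotCount m h) (ballotCount-tooHigh m (suc (suc h)) (s≤s (ℕ.m≤n⇒m≤1+n (ℕ.≤-reflexive m≡h)))))
                   (k>n⇒nCk≡0 (s≤s (s≤s (ℕ.≤-reflexive (trans m≡h (sym (ℕ.+-identityʳ h))))))) ⟩
    ballotCount m h + 0
      ≡⟨ cong (ballotCount m h +_) (k>n⇒nCk≡0 (s≤s (ℕ.≤-reflexive (ℕ.suc-injective eq)))) ⟨
    ballotCount m h + m C suc (h + 0)
      ≡⟨ ballotCount+binomial m h 0 (ℕ.suc-injective eq) ⟩
    1 ∎
    where
    m≡h : m ≡ h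
    m≡h = trans (ℕ.suc-injective eq) (ℕ.+-identityʳ h)
  ballotCount+binomial (suc m) (suc h) (suc u) eq   = begin
    ballotCount m (suc (suc h)) + ballotCount m h + suc m C suc (suc (h + suc u))
      ≡⟨ cong (ballotCount m (suc (suc h)) + ballotCount m h +_) (pascal m (suc (h + suc u))) ⟩
    ballotCount m (suc (suc h)) + ballotCount m h + (m C suc (h + suc u) + m C suc (suc (h + suc u)))
      ≡⟨ [x+y]+[z+w]≡[x+w]+[y+z] (ballotCount m (suc (suc h))) (ballotCount m h) _ _ ⟩
    (ballotCount m (suc (suc h)) + m C suc (suc (h + suc u))) + (ballotCount m h + m C suc (h + suc u))
      ≡⟨ cong₂ _+_ (trans (cong (λ k → ballotCount m (suc (suc h)) + m C suc (suc k)) (ℕ.+-suc h u))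
                          (ballotCount+binomial m (suc (suc h)) u m≡h+2+2u))
                   (ballotCount+binomial m h (suc u) m≡h+2[u+1]) ⟩
    m C u + m C suc u
      ≡⟨ pascal m u ⟨
    suc m C suc u ∎
    where
    m≡h+2[u+1] : m ≡ h + (suc u + suc u)
    m≡h+2[u+1] = ℕ.suc-injective eq
    m≡h+2+2u : m ≡ suc (suc h) + (u + u)
    m≡h+2+2u = trans m≡h+2[u+1] (solve 2 (λ h u → h :+ ((con 1 :+ u) :+ (con 1 :+ u)) := (con 2 :+ h) :+ (u :+ u)) refl h u)
    [x+y]+[z+w]≡[x+w]+[y+z] : ∀ x y z w → x + y + (z + w) ≡ (x + w) + (y + z)
    [x+y]+[z+w]≡[x+w]+[y+z] = solve 4 (λ x y z w → x :+ y :+ (z :+ w) := (x :+ w) :+ (y :+ z)) refl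

  binomial-absorption : ∀ M k → suc k * (M C suc k) + k * (M C k) ≡ M * (M C k)
  binomial-absorption zero    zero    = refl
  binomial-absorption zero    (suc k) = cong₂ _+_ (ℕ.*-zeroʳ (suc (suc k))) (ℕ.*-zeroʳ (suc k))
  binomial-absorption (suc M) zero    = begin
    1 * (suc M C 1) + 0 ≡⟨ trans (ℕ.+-identityʳ _) (ℕ.*-identityˡ _) ⟩
    suc M C 1           ≡⟨ nC1≡n (suc M) ⟩
    suc M               ≡⟨ ℕ.*-identityʳ (suc M) ⟨
    suc M * 1           ∎
  binomial-absorption (suc M) (suc j) = begin
    suc (suc j) * (suc M C suc (suc j)) + suc j * (suc M C suc j)
      ≡⟨ cong₂ _+_ (cong (suc (suc j) *_) (pascal M (suc j))) (cong (suc j *_) (pascal M j)) ⟩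
    suc (suc j) * (y + z) + suc j * (x + y)
      ≡⟨ solve 4 (λ j x y z → (con 2 :+ j) :* (y :+ z) :+ (con 1 :+ j) :* (x :+ y)
                           := ((con 2 :+ j) :* z :+ (con 1 :+ j) :* y) :+ (y :+ x :+ ((con 1 :+ j) :* y :+ j :* x))) refl j x y z ⟩
    (suc (suc j) * z + suc j * y) + (y + x + (suc j * y + j * x))
      ≡⟨ cong₂ (λ a b → a + (y + x + b)) (binomial-absorption M (suc j)) (binomial-absorption M j) ⟩
    M * y + (y + x + M * x)
      ≡⟨ solve 3 (λ M x y → M :* y :+ (y :+ x :+ M :* x) := (con 1 :+ M) :* (x :+ y)) refl M x y ⟩
    suc M * (x + y)
      ≡⟨ cong (suc M *_) (pascal M j) ⟨
    suc M * (suc M C suc j) ∎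
    where
    x = M C j
    y = M C suc j
    z = M C suc (suc j)

  -- With b the number of Dyck paths: b + C(2n, n+1) = C(2n, n) by the reflection principle,
  -- and (n+1) C(2n, n+1) = n C(2n, n) by absorption; so (n+1) b = C(2n, n).
  dyckCount≡catalan : ∀ n → dyckCount n ≡ catalan n
  dyckCount≡catalan n = begin
    dyckCount n             ≡⟨ sumWords-ballotCount (2 * n) 0 ⟩
    b                       ≡⟨ m*n/n≡m b (suc n) ⟨
    (b * suc n) / suc n     ≡⟨ cong (_/ suc n) (trans (ℕ.*-comm b (suc n)) [n+1]b≡C) ⟩
    ((2 * n) C n) / suc n   ∎
    where
    b = ballotCount (2 * n) 0
    C₀ = (2 * n) C n
    C₁ = (2 * n) C suc n
    b+C₁≡C₀ : b + C₁ ≡ C₀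
    b+C₁≡C₀ = ballotCount+binomial (2 * n) 0 n (cong (n +_) (ℕ.+-identityʳ n))
    [n+1]C₁≡nC₀ : suc n * C₁ ≡ n * C₀
    [n+1]C₁≡nC₀ = ℕ.+-cancelʳ-≡ (n * C₀) _ _ (begin
      suc n * C₁ + n * C₀   ≡⟨ binomial-absorption (2 * n) n ⟩
      (2 * n) * C₀          ≡⟨ cong (_* C₀) (cong (n +_) (ℕ.+-identityʳ n)) ⟩
      (n + n) * C₀          ≡⟨ ℕ.*-distribʳ-+ C₀ n n ⟩
      n * C₀ + n * C₀       ∎)
    [n+1]b≡C : suc n * b ≡ C₀
    [n+1]b≡C = ℕ.+-cancelʳ-≡ (n * C₀) _ _ (begin
      suc n * b + n * C₀        ≡⟨ cong (suc n * b +_) [n+1]C₁≡nC₀ ⟨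
      suc n * b + suc n * C₁    ≡⟨ ℕ.*-distribˡ-+ (suc n) b C₁ ⟨
      suc n * (b + C₁)          ≡⟨ cong (suc n *_) b+C₁≡C₀ ⟩
      suc n * C₀                ≡⟨⟩
      C₀ + n * C₀               ∎)

module DefsAsPowerSeries where

  open import Defs
  open import Data.Nat as ℕ using (zero; suc)
  import Data.Integer as ℤ
  open import Relation.Binary.PropositionalEquality as ≡ using (_≡_; refl)

  open ℤ[[x]] using (Σ≤; 𝟎; 𝐗; ⊛-convolution; ⊕-coeff; ⊝-coeff; coefficientwise; coeff; _≐_)
  open CommutativeRing ℤ[[x]].powerSeriesRing using (_+_; _*_; _-_; 1#; trans; *-congˡ; +-congʳ)

  sumUpTo≡Σ≤ : ∀ n f → sumUpTo n f ≡ Σ≤ n f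
  sumUpTo≡Σ≤ zero    f = refl
  sumUpTo≡Σ≤ (suc n) f = ≡.cong (ℤ._+ f (suc n)) (sumUpTo≡Σ≤ n f)

  ⊕≐+ : ∀ f g → f ⊕ g ≐ f + g
  ⊕≐+ f g = coefficientwise λ n → ≡.sym (⊕-coeff f g n)

  ⊖≐- : ∀ f g → f ⊖ g ≐ f - g
  ⊖≐- f g = coefficientwise λ n → ≡.sym (≡.trans (⊕-coeff f _ n) (≡.cong (λ a → f n ℤ.+ a) (⊝-coeff g n)))

  ⊛≐* : ∀ f g → f ⊛ g ≐ f * g
  ⊛≐* f g = coefficientwise λ n → ≡.trans (sumUpTo≡Σ≤ n _) (≡.sym (⊛-convolution f g n))

  𝟙≐1# : 𝟙 ≐ 1#
  𝟙≐1# = coefficientwise λ { zero → refl ; (suc n) → refl }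

  𝟘≐0# : 𝟘 ≐ 𝟎
  𝟘≐0# = coefficientwise λ { zero → refl ; (suc n) → refl }

  X≐𝐗 : X ≐ 𝐗
  X≐𝐗 = coefficientwise λ { zero → refl ; (suc zero) → refl ; (suc (suc n)) → refl }

  ^^≐^ : ∀ f m → f ^^ m ≐ f ℤ[[x]].^ m
  ^^≐^ f zero    = 𝟙≐1#
  ^^≐^ f (suc m) = trans (⊛≐* f (f ^^ m)) (*-congˡ (^^≐^ f m))

  inv≐inv : ∀ f → inv f ≐ ℤ[[x]].inv f
  inv≐inv f = coefficientwise λ n → ≡.trans (sumUpTo≡Σ≤ n _)
    (ℤ[[x]].Σ≤-cong n (λ j → coeff (trans (^^≐^ (𝟙 ⊖ f) j) (ℤ[[x]].^-congˡ j (trans (⊖≐- 𝟙 f) (+-congʳ 𝟙≐1#)))) n))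

module Chebyshev where

  open DefsAsPowerSeries
  open import Defs using (UU; Cat; X; _⊛_)
  open import Data.Nat using (ℕ; zero; suc)
  open import Data.Integer as ℤ using (1ℤ)
  open import Relation.Binary.PropositionalEquality as ≡ using (_≡_)

  open ℤ[[x]] using (𝐗; inv; ⊛-inv; _^_)
  open CommutativeRing ℤ[[x]].powerSeriesRing
  open IntegerCoefficientSolver ℤ[[x]].powerSeriesRing using (solve; _:=_; _:+_; _:*_; _:-_; :1)
  open CommutativeRingLemmas ℤ[[x]].powerSeriesRing using (inverse-unique)
  open import Relation.Binary.Reasoning.Setoid setoid

  UU-constant : ∀ k → UU k 0 ≡ 1ℤ
  UU-constant zero          = ≡.refl
  UU-constant (suc zero)    = ≡.refl
  UU-constant (suc (suc k)) = ≡.cong (λ a → a ℤ.- (X ⊛ UU k) 0) (UU-constant (suc k))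

  UU-suc-suc : ∀ k → UU (suc (suc k)) ≈ UU (suc k) - 𝐗 * UU k
  UU-suc-suc k = trans (⊖≐- (UU (suc k)) (X ⊛ UU k)) (+-congˡ (-‿cong (trans (⊛≐* X (UU k)) (*-congʳ X≐𝐗))))

  UU-inverse : ∀ k → UU k * inv (UU k) ≈ 1#
  UU-inverse k = ⊛-inv (UU k) (UU-constant k)

  inv-UU² : ∀ k → inv (UU k * UU k) ≈ inv (UU k) * inv (UU k)
  inv-UU² k = inverse-unique
    (trans (*-comm _ _) (⊛-inv (UU k * UU k) (≡.cong₂ ℤ._*_ (UU-constant k) (UU-constant k))))
    (begin
      (inv (UU k) * inv (UU k)) * (UU k * UU k)
        ≈⟨ solve 2 (λ u i → (i :* i) :* (u :* u) := (u :* i) :* (u :* i)) refl (UU k) (inv (UU k)) ⟩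
      (UU k * inv (UU k)) * (UU k * inv (UU k)) ≈⟨ *-cong (UU-inverse k) (UU-inverse k) ⟩
      1# * 1#                                   ≈⟨ *-identityˡ 1# ⟩
      1#                                        ∎)

  -- U_{k+1}² - U_k U_{k+2} = 1, homogenised, with U_{k+2} expanded by the recurrence.
  cassini : ∀ k → UU (suc k) * UU (suc k) - UU k * UU (suc k) + 𝐗 * UU k * UU k ≈ 𝐗 ^ suc k
  cassini zero    = begin
    UU 1 * UU 1 - UU 1 * UU 1 + 𝐗 * UU 1 * UU 1
      ≈⟨ +-cong (+-cong (*-cong 𝟙≐1# 𝟙≐1#) (-‿cong (*-cong 𝟙≐1# 𝟙≐1#))) (*-cong (*-congˡ 𝟙≐1#) 𝟙≐1#) ⟩
    1# * 1# - 1# * 1# + 𝐗 * 1# * 1#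
      ≈⟨ solve 1 (λ x → :1 :* :1 :- :1 :* :1 :+ x :* :1 :* :1 := x :* :1) refl 𝐗 ⟩
    𝐗 * 1# ∎
  cassini (suc k) = begin
    u₂ * u₂ - u₁ * u₂ + 𝐗 * u₁ * u₁
      ≈⟨ +-congʳ (+-cong (*-cong (UU-suc-suc k) (UU-suc-suc k)) (-‿cong (*-congˡ (UU-suc-suc k)))) ⟩
    (u₁ - 𝐗 * u₀) * (u₁ - 𝐗 * u₀) - u₁ * (u₁ - 𝐗 * u₀) + 𝐗 * u₁ * u₁
      ≈⟨ solve 3 (λ x a b → (b :- x :* a) :* (b :- x :* a) :- b :* (b :- x :* a) :+ x :* b :* b
                          := x :* (b :* b :- a :* b :+ x :* a :* a)) refl 𝐗 u₀ u₁ ⟩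
    𝐗 * (u₁ * u₁ - u₀ * u₁ + 𝐗 * u₀ * u₀)
      ≈⟨ *-congˡ (cassini k) ⟩
    𝐗 * 𝐗 ^ suc k ∎
    where
    u₀ = UU k
    u₁ = UU (suc k)
    u₂ = UU (suc (suc k))

  -- R_{k+1}, 1/U_{k+1}² and the denominator 1 - x (R_{k+1} - 1) C of the theorem.
  ratio weight denominator : ℕ → ℤ[[x]].Series
  ratio k       = UU k * inv (UU (suc k))
  weight k      = 𝐗 ^ suc k * inv (UU (suc k) * UU (suc k))
  denominator k = 1# - 𝐗 * (ratio k - 1#) * Cat

  ratio-zero : ratio 0 ≈ 1#
  ratio-zero = UU-inverse 1

  ratio-recurrence : ∀ k → ratio (suc k) * (1# - 𝐗 * ratio k) ≈ 1#
  ratio-recurrence k = begin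
    (u₁ * i₂) * (1# - 𝐗 * (u₀ * i₁))
      ≈⟨ solve 5 (λ u₀ u₁ i₁ i₂ x → (u₁ :* i₂) :* (:1 :- x :* (u₀ :* i₁)) := i₂ :* u₁ :- (i₂ :* x :* u₀) :* (u₁ :* i₁))
                 refl u₀ u₁ i₁ i₂ 𝐗 ⟩
    i₂ * u₁ - (i₂ * 𝐗 * u₀) * (u₁ * i₁) ≈⟨ +-congˡ (-‿cong (*-congˡ (UU-inverse (suc k)))) ⟩
    i₂ * u₁ - (i₂ * 𝐗 * u₀) * 1#
      ≈⟨ solve 4 (λ u₀ u₁ i₂ x → i₂ :* u₁ :- (i₂ :* x :* u₀) :* :1 := (u₁ :- x :* u₀) :* i₂) refl u₀ u₁ i₂ 𝐗 ⟩
    (u₁ - 𝐗 * u₀) * i₂                  ≈⟨ *-congʳ (UU-suc-suc k) ⟨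
    UU (suc (suc k)) * i₂               ≈⟨ UU-inverse (suc (suc k)) ⟩
    1#                                  ∎
    where
    u₀ = UU k
    u₁ = UU (suc k)
    i₁ = inv (UU (suc k))
    i₂ = inv (UU (suc (suc k)))

  weight≈ratio : ∀ k → weight k ≈ 1# - ratio k + 𝐗 * ratio k * ratio k
  weight≈ratio k = begin
    𝐗 ^ suc k * inv (u₁ * u₁)
      ≈⟨ *-cong (sym (cassini k)) (inv-UU² (suc k)) ⟩
    (u₁ * u₁ - u₀ * u₁ + 𝐗 * u₀ * u₀) * (i₁ * i₁)
      ≈⟨ solve 4 (λ u₀ u₁ i₁ x → (u₁ :* u₁ :- u₀ :* u₁ :+ x :* u₀ :* u₀) :* (i₁ :* i₁)
                  := (u₁ :* i₁) :* (u₁ :* i₁) :- (u₀ :* i₁) :* (u₁ :* i₁) :+ x :* (u₀ :* i₁) :* (u₀ :* i₁))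
                 refl u₀ u₁ i₁ 𝐗 ⟩
    (u₁ * i₁) * (u₁ * i₁) - ratio k * (u₁ * i₁) + 𝐗 * ratio k * ratio k
      ≈⟨ +-congʳ (+-cong (*-cong (UU-inverse (suc k)) (UU-inverse (suc k))) (-‿cong (*-congˡ (UU-inverse (suc k))))) ⟩
    1# * 1# - ratio k * 1# + 𝐗 * ratio k * ratio k
      ≈⟨ solve 2 (λ a x → :1 :* :1 :- a :* :1 :+ x :* a :* a := :1 :- a :+ x :* a :* a) refl (ratio k) 𝐗 ⟩
    1# - ratio k + 𝐗 * ratio k * ratio k ∎
    where
    u₀ = UU k
    u₁ = UU (suc k)
    i₁ = inv (UU (suc k))

  weight-zero : weight 0 ≈ 𝐗
  weight-zero = begin
    weight 0                          ≈⟨ weight≈ratio 0 ⟩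
    1# - ratio 0 + 𝐗 * ratio 0 * ratio 0 ≈⟨ +-cong (+-congˡ (-‿cong ratio-zero)) (*-cong (*-congˡ ratio-zero) ratio-zero) ⟩
    1# - 1# + 𝐗 * 1# * 1#             ≈⟨ solve 1 (λ x → :1 :- :1 :+ x :* :1 :* :1 := x) refl 𝐗 ⟩
    𝐗                                 ∎

  weight-suc : ∀ k → weight (suc k) ≈ ratio (suc k) * ratio (suc k) * 𝐗 * weight k
  weight-suc k = begin
    (𝐗 * 𝐗 ^ suc k) * inv (u₂ * u₂)
      ≈⟨ *-congˡ (inv-UU² (suc (suc k))) ⟩
    (𝐗 * 𝐗 ^ suc k) * (i₂ * i₂)
      ≈⟨ solve 3 (λ x p i → x :* p :* (i :* i) := x :* p :* (i :* i) :* (:1 :* :1)) refl 𝐗 (𝐗 ^ suc k) i₂ ⟩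
    (𝐗 * 𝐗 ^ suc k) * (i₂ * i₂) * (1# * 1#)
      ≈⟨ *-congˡ (*-cong (UU-inverse (suc k)) (UU-inverse (suc k))) ⟨
    (𝐗 * 𝐗 ^ suc k) * (i₂ * i₂) * ((u₁ * i₁) * (u₁ * i₁))
      ≈⟨ solve 5 (λ x p i u j → x :* p :* (i :* i) :* ((u :* j) :* (u :* j)) := (u :* i) :* (u :* i) :* x :* (p :* (j :* j)))
                 refl 𝐗 (𝐗 ^ suc k) i₂ u₁ i₁ ⟩
    ratio (suc k) * ratio (suc k) * 𝐗 * (𝐗 ^ suc k * (i₁ * i₁))
      ≈⟨ *-congˡ (*-congˡ (inv-UU² (suc k))) ⟨
    ratio (suc k) * ratio (suc k) * 𝐗 * weight k ∎
    where
    u₁ = UU (suc k)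
    u₂ = UU (suc (suc k))
    i₁ = inv (UU (suc k))
    i₂ = inv (UU (suc (suc k)))

  ratio-suc*weight : ∀ k → ratio (suc k) * weight k ≈ ratio (suc k) - ratio k
  ratio-suc*weight k = begin
    a₁ * weight k                        ≈⟨ *-congˡ (weight≈ratio k) ⟩
    a₁ * (1# - a₀ + 𝐗 * a₀ * a₀)
      ≈⟨ solve 3 (λ a₀ a₁ x → a₁ :* (:1 :- a₀ :+ x :* a₀ :* a₀) := a₁ :- a₀ :* (a₁ :* (:1 :- x :* a₀))) refl a₀ a₁ 𝐗 ⟩
    a₁ - a₀ * (a₁ * (1# - 𝐗 * a₀))       ≈⟨ +-congˡ (-‿cong (*-congˡ (ratio-recurrence k))) ⟩
    a₁ - a₀ * 1#                         ≈⟨ +-congˡ (-‿cong (*-identityʳ a₀)) ⟩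
    a₁ - a₀                              ∎
    where
    a₀ = ratio k
    a₁ = ratio (suc k)

  denominator-zero : denominator 0 ≈ 1#
  denominator-zero = begin
    1# - 𝐗 * (ratio 0 - 1#) * Cat   ≈⟨ +-congˡ (-‿cong (*-congʳ (*-congˡ (+-congʳ ratio-zero)))) ⟩
    1# - 𝐗 * (1# - 1#) * Cat        ≈⟨ solve 2 (λ x c → :1 :- x :* (:1 :- :1) :* c := :1) refl 𝐗 Cat ⟩
    1#                              ∎

  denominator-constant : ∀ k → denominator k 0 ≡ 1ℤ
  denominator-constant k = ≡.refl

  denominator-suc : ∀ k → denominator (suc k) ≈ denominator k - ratio (suc k) * 𝐗 * weight k * Cat
  denominator-suc k = sym (begin
    1# - 𝐗 * (a₀ - 1#) * Cat - a₁ * 𝐗 * weight k * Cat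
      ≈⟨ solve 5 (λ a₀ a₁ e x c → :1 :- x :* (a₀ :- :1) :* c :- a₁ :* x :* e :* c
                               := :1 :- x :* (a₀ :- :1) :* c :- x :* (a₁ :* e) :* c) refl a₀ a₁ (weight k) 𝐗 Cat ⟩
    1# - 𝐗 * (a₀ - 1#) * Cat - 𝐗 * (a₁ * weight k) * Cat
      ≈⟨ +-congˡ (-‿cong (*-congʳ (*-congˡ (ratio-suc*weight k)))) ⟩
    1# - 𝐗 * (a₀ - 1#) * Cat - 𝐗 * (a₁ - a₀) * Cat
      ≈⟨ solve 4 (λ a₀ a₁ x c → :1 :- x :* (a₀ :- :1) :* c :- x :* (a₁ :- a₀) :* c := :1 :- x :* (a₁ :- :1) :* c)
                 refl a₀ a₁ 𝐗 Cat ⟩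
    denominator (suc k) ∎)
    where
    a₀ = ratio k
    a₁ = ratio (suc k)

module GeneratingFunctions where

  open WordSums using (Σ≤ℕ; Σ≤ℕ-cong; Σ≤ℕ-comm; Σ≤ℕ-suc; Σ≤ℕ-zero)
  open PathDecomposition using (χ)
  open ValleyCounts
  open CatalanCount using (dyckCount≡catalan)
  open DefsAsPowerSeries
  open import Defs using (Valley; valley; Cat; catalan)
  open import Data.Nat as ℕ using (ℕ; zero; suc; _∸_; _≡ᵇ_)
  import Data.Nat.Properties as ℕ
  open import Data.Integer as ℤ using (+_)
  import Data.Integer.Properties as ℤ
  open import Relation.Binary.PropositionalEquality as ≡ using (_≡_; refl)

  private
    module ℤx = CommutativeRing ℤ[[x]].powerSeriesRing
    module ℤxy = CommutativeRing ℤ[[x,y]].powerSeriesRing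
  open ℤ[[x]] using (𝐗) renaming (_⊛_ to _⊛ˣ_)
  open ℤ[[x,y]] using (constant) renaming (_⊛_ to _⊛ʸ_; 𝐗 to 𝐘)

  -- A series in y whose coefficients are series in x: Σ_{r,n} valley_k^r(n) yʳ xⁿ.
  valleySeries : ℕ → ℤ[[x,y]].Series
  valleySeries k r = Valley k r

  +-Σ≤ℕ : ∀ n F → + Σ≤ℕ n F ≡ ℤ[[x]].Σ≤ n (λ i → + F i)
  +-Σ≤ℕ zero    F = refl
  +-Σ≤ℕ (suc n) F = ≡.cong (ℤ._+ + F (suc n)) (+-Σ≤ℕ n F)

  ⊛ˣ-ℕ : ∀ (p q : ℕ → ℕ) n → ((λ i → + p i) ⊛ˣ (λ j → + q j)) n ≡ + Σ≤ℕ n (λ i → p i ℕ.* q (n ∸ i))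
  ⊛ˣ-ℕ p q n = ≡.trans (ℤ[[x]].⊛-convolution _ _ n)
    (≡.trans (ℤ[[x]].Σ≤-cong n (λ i → ≡.sym (ℤ.pos-* (p i) (q (n ∸ i))))) (≡.sym (+-Σ≤ℕ n _)))

  Σ≤ʸ-coeff : ∀ r (F : ℕ → ℤ[[x]].Series) n → ℤ[[x,y]].Σ≤ r F n ≡ ℤ[[x]].Σ≤ r (λ a → F a n)
  Σ≤ʸ-coeff zero    F n = refl
  Σ≤ʸ-coeff (suc r) F n = ≡.trans (ℤ[[x]].⊕-coeff (ℤ[[x,y]].Σ≤ r F) (F (suc r)) n)
                                  (≡.cong (ℤ._+ F (suc r) n) (Σ≤ʸ-coeff r F n))

  ⊛ʸ-ℕ : ∀ (P Q : ℕ → ℕ → ℕ) r n →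
    ((λ a i → + P a i) ⊛ʸ (λ b j → + Q b j)) r n ≡ + Σ≤ℕ n (λ i → Σ≤ℕ r (λ a → P a i ℕ.* Q (r ∸ a) (n ∸ i)))
  ⊛ʸ-ℕ P Q r n = begin
    ((λ a i → + P a i) ⊛ʸ (λ b j → + Q b j)) r n
      ≡⟨ ℤ[[x]].coeff (ℤ[[x,y]].⊛-convolution _ _ r) n ⟩
    ℤ[[x,y]].Σ≤ r (λ a → (λ i → + P a i) ⊛ˣ (λ j → + Q (r ∸ a) j)) n
      ≡⟨ Σ≤ʸ-coeff r _ n ⟩
    ℤ[[x]].Σ≤ r (λ a → ((λ i → + P a i) ⊛ˣ (λ j → + Q (r ∸ a) j)) n)
      ≡⟨ ℤ[[x]].Σ≤-cong r (λ a → ⊛ˣ-ℕ (P a) (Q (r ∸ a)) n) ⟩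
    ℤ[[x]].Σ≤ r (λ a → + Σ≤ℕ n (λ i → P a i ℕ.* Q (r ∸ a) (n ∸ i)))
      ≡⟨ +-Σ≤ℕ r _ ⟨
    + Σ≤ℕ r (λ a → Σ≤ℕ n (λ i → P a i ℕ.* Q (r ∸ a) (n ∸ i)))
      ≡⟨ ≡.cong +_ (Σ≤ℕ-comm r n _) ⟩
    + Σ≤ℕ n (λ i → Σ≤ℕ r (λ a → P a i ℕ.* Q (r ∸ a) (n ∸ i))) ∎
    where open ≡.≡-Reasoning

  1+xF-coeff-zero : ∀ F r → (ℤxy.1# ℤxy.+ constant 𝐗 ℤxy.* F) r 0 ≡ + χ (0 ≡ᵇ r)
  1+xF-coeff-zero F r = begin
    (ℤxy.1# ℤxy.+ constant 𝐗 ℤxy.* F) r 0         ≡⟨ ℤ[[x]].coeff (ℤ[[x,y]].⊕-coeff ℤxy.1# _ r) 0 ⟩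
    ℤxy.1# r 0 ℤ.+ (constant 𝐗 ⊛ʸ F) r 0           ≡⟨ ≡.cong (λ z → ℤxy.1# r 0 ℤ.+ z) (ℤ[[x]].coeff (ℤ[[x,y]].constant-⊛ 𝐗 F r) 0) ⟩
    ℤxy.1# r 0 ℤ.+ (𝐗 ⊛ˣ F r) 0                    ≡⟨ ℤ.+-identityʳ _ ⟩
    ℤxy.1# r 0                                     ≡⟨ 1ʸ-coeff-zero r ⟩
    + χ (0 ≡ᵇ r) ∎
    where
    open ≡.≡-Reasoning
    1ʸ-coeff-zero : ∀ r → ℤxy.1# r 0 ≡ + χ (0 ≡ᵇ r)
    1ʸ-coeff-zero zero    = refl
    1ʸ-coeff-zero (suc r) = refl

  1+xF-coeff-suc : ∀ F r n → (ℤxy.1# ℤxy.+ constant 𝐗 ℤxy.* F) r (suc n) ≡ F r n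
  1+xF-coeff-suc F r n = begin
    (ℤxy.1# ℤxy.+ constant 𝐗 ℤxy.* F) r (suc n)         ≡⟨ ℤ[[x]].coeff (ℤ[[x,y]].⊕-coeff ℤxy.1# _ r) (suc n) ⟩
    ℤxy.1# r (suc n) ℤ.+ (constant 𝐗 ⊛ʸ F) r (suc n)     ≡⟨ ≡.cong₂ ℤ._+_ (1ʸ-coeff-suc r) (ℤ[[x]].coeff (ℤ[[x,y]].constant-⊛ 𝐗 F r) (suc n)) ⟩
    + 0 ℤ.+ (𝐗 ⊛ˣ F r) (suc n)                          ≡⟨ ℤ.+-identityˡ _ ⟩
    (𝐗 ⊛ˣ F r) (suc n)                                  ≡⟨ ℤ[[x]].𝐗-⊛-suc (F r) n ⟩
    F r n ∎
    where
    open ≡.≡-Reasoning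
    1ʸ-coeff-suc : ∀ r → ℤxy.1# r (suc n) ≡ + 0
    1ʸ-coeff-suc zero    = refl
    1ʸ-coeff-suc (suc r) = refl

  valleySeries-suc : ∀ ℓ → valleySeries (suc ℓ) ℤxy.≈ ℤxy.1# ℤxy.+ constant 𝐗 ℤxy.* (valleySeries ℓ ℤxy.* valleySeries (suc ℓ))
  valleySeries-suc ℓ = ℤ[[x,y]].coefficientwise λ r → ℤ[[x]].coefficientwise λ
    { zero    → ≡.trans (≡.cong +_ (valley-zero (suc ℓ) r)) (≡.sym (1+xF-coeff-zero _ r))
    ; (suc n) → ≡.sym (begin
        (ℤxy.1# ℤxy.+ constant 𝐗 ℤxy.* (valleySeries ℓ ℤxy.* valleySeries (suc ℓ))) r (suc n)
          ≡⟨ 1+xF-coeff-suc _ r n ⟩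
        (valleySeries ℓ ⊛ʸ valleySeries (suc ℓ)) r n
          ≡⟨ ⊛ʸ-ℕ (valley ℓ) (valley (suc ℓ)) r n ⟩
        + Σ≤ℕ n (λ i → Σ≤ℕ r (λ s → valley ℓ s i ℕ.* valley (suc ℓ) (r ∸ s) (n ∸ i)))
          ≡⟨ ≡.cong +_ (Σ≤ℕ-cong n (λ i _ → Σ≤ℕ-cong r (λ s _ →
               ≡.sym (≡.cong₂ ℕ._*_ (liftedCount-suc ℓ s i) (returnCount-suc ℓ (r ∸ s) (n ∸ i)))))) ⟩
        + Σ≤ℕ n (λ i → Σ≤ℕ r (λ s → liftedCount (suc ℓ) s i ℕ.* returnCount (suc ℓ) (r ∸ s) (n ∸ i)))
          ≡⟨ ≡.cong +_ (valley-suc (suc ℓ) r n) ⟨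
        Valley (suc ℓ) r (suc n) ∎)
    }
    where open ≡.≡-Reasoning

  returnSeries : ℤ[[x,y]].Series
  returnSeries = ℤxy.1# ℤxy.+ 𝐘 ℤxy.* (valleySeries 0 ℤxy.- ℤxy.1#)

  returnSeries-coeff : ∀ r j → returnSeries r j ≡ + returnCount 0 r j
  returnSeries-coeff zero    j = begin
    returnSeries 0 j
      ≡⟨ ℤ[[x]].coeff (ℤ[[x,y]].⊕-coeff ℤxy.1# (𝐘 ℤxy.* (valleySeries 0 ℤxy.- ℤxy.1#)) 0) j ⟩
    (ℤxy.1# 0 ℤx.+ (𝐘 ⊛ʸ (valleySeries 0 ℤxy.- ℤxy.1#)) 0) j
      ≡⟨ ℤ[[x]].coeff (ℤx.+-congˡ {ℤxy.1# 0} (ℤ[[x,y]].𝐗-⊛-zero (valleySeries 0 ℤxy.- ℤxy.1#))) j ⟩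
    (ℤxy.1# 0 ℤx.+ ℤx.0#) j                   ≡⟨ ℤ[[x]].coeff (ℤx.+-identityʳ (ℤxy.1# 0)) j ⟩
    ℤxy.1# 0 j                                ≡⟨ 1ʸ₀-coeff j ⟩
    + χ (j ≡ᵇ 0)                              ≡⟨ ≡.cong +_ (returnCount-zero-zero j) ⟨
    + returnCount 0 0 j                       ∎
    where
    open ≡.≡-Reasoning
    1ʸ₀-coeff : ∀ j → ℤxy.1# 0 j ≡ + χ (j ≡ᵇ 0)
    1ʸ₀-coeff zero    = refl
    1ʸ₀-coeff (suc j) = refl
  returnSeries-coeff (suc r) j = begin
    returnSeries (suc r) j                        ≡⟨ ℤ[[x]].coeff returnSeries-suc j ⟩
    (Valley 0 r ℤx.- ℤxy.1# r) j                  ≡⟨ ℤ[[x]].⊕-coeff (Valley 0 r) _ j ⟩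
    + valley 0 r j ℤ.+ ℤ[[x]].⊝_ (ℤxy.1# r) j     ≡⟨ ≡.cong (λ z → + valley 0 r j ℤ.+ z) (ℤ[[x]].⊝-coeff (ℤxy.1# r) j) ⟩
    + valley 0 r j ℤ.- ℤxy.1# r j                 ≡⟨ ≡.cong₂ ℤ._-_ (≡.cong +_ (≡.sym (returnCount-zero-suc r j))) (1ʸ-coeff r j) ⟩
    + (returnCount 0 (suc r) j ℕ.+ d) ℤ.- + d     ≡⟨ ≡.cong (ℤ._- + d) (ℤ.pos-+ (returnCount 0 (suc r) j) d) ⟩
    + returnCount 0 (suc r) j ℤ.+ + d ℤ.- + d     ≡⟨ solve 2 (λ a b → a :+ b :- b := a) refl (+ returnCount 0 (suc r) j) (+ d) ⟩
    + returnCount 0 (suc r) j                     ∎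
    where
    open ≡.≡-Reasoning
    open import Data.Integer.Solver using (module +-*-Solver)
    open +-*-Solver using (solve; _:=_; _:+_; _:-_)
    d = χ (j ≡ᵇ 0) ℕ.* χ (r ≡ᵇ 0)
    returnSeries-suc : returnSeries (suc r) ℤx.≈ Valley 0 r ℤx.- ℤxy.1# r
    returnSeries-suc = ℤx.trans (ℤx.+-identityˡ _) (ℤx.trans (ℤ[[x,y]].𝐗-⊛-suc _ r)
      (ℤx.trans (ℤ[[x,y]].⊕-coeff (valleySeries 0) _ r) (ℤx.+-congˡ (ℤ[[x,y]].⊝-coeff ℤxy.1# r))))
    1ʸ-coeff : ∀ r j → ℤxy.1# r j ≡ + (χ (j ≡ᵇ 0) ℕ.* χ (r ≡ᵇ 0))
    1ʸ-coeff zero    zero    = refl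
    1ʸ-coeff zero    (suc j) = refl
    1ʸ-coeff (suc r) zero    = refl
    1ʸ-coeff (suc r) (suc j) = refl

  Σ≤ℕ-χ[0≡ᵇ] : ∀ r (F : ℕ → ℕ) → Σ≤ℕ r (λ s → χ (0 ≡ᵇ s) ℕ.* F s) ≡ F 0
  Σ≤ℕ-χ[0≡ᵇ] zero    F = ℕ.+-identityʳ (F 0)
  Σ≤ℕ-χ[0≡ᵇ] (suc r) F = ≡.trans (Σ≤ℕ-suc r (λ s → χ (0 ≡ᵇ s) ℕ.* F s))
    (≡.trans (≡.cong₂ ℕ._+_ (ℕ.+-identityʳ (F 0)) (Σ≤ℕ-zero r _ (λ _ → refl))) (ℕ.+-identityʳ (F 0)))

  valleySeries-zero : valleySeries 0 ℤxy.≈ ℤxy.1# ℤxy.+ constant 𝐗 ℤxy.* (constant Cat ℤxy.* returnSeries)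
  valleySeries-zero = ℤ[[x,y]].coefficientwise λ r → ℤ[[x]].coefficientwise λ
    { zero    → ≡.trans (≡.cong +_ (valley-zero 0 r)) (≡.sym (1+xF-coeff-zero _ r))
    ; (suc n) → ≡.sym (begin
        (ℤxy.1# ℤxy.+ constant 𝐗 ℤxy.* (constant Cat ℤxy.* returnSeries)) r (suc n)
          ≡⟨ 1+xF-coeff-suc _ r n ⟩
        (constant Cat ⊛ʸ returnSeries) r n
          ≡⟨ ℤ[[x]].coeff (ℤ[[x,y]].constant-⊛ Cat returnSeries r) n ⟩
        (Cat ⊛ˣ returnSeries r) n
          ≡⟨ ℤ[[x]].⊛-cong (λ _ → refl) (returnSeries-coeff r) n ⟩
        (Cat ⊛ˣ (λ j → + returnCount 0 r j)) n
          ≡⟨ ⊛ˣ-ℕ catalan (returnCount 0 r) n ⟩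
        + Σ≤ℕ n (λ i → catalan i ℕ.* returnCount 0 r (n ∸ i))
          ≡⟨ ≡.cong +_ (Σ≤ℕ-cong n (λ i _ → lifted-zero r n i)) ⟩
        + Σ≤ℕ n (λ i → Σ≤ℕ r (λ s → liftedCount 0 s i ℕ.* returnCount 0 (r ∸ s) (n ∸ i)))
          ≡⟨ ≡.cong +_ (valley-suc 0 r n) ⟨
        Valley 0 r (suc n) ∎)
    }
    where
    open ≡.≡-Reasoning
    lifted-zero : ∀ r n i → catalan i ℕ.* returnCount 0 r (n ∸ i)
                            ≡ Σ≤ℕ r (λ s → liftedCount 0 s i ℕ.* returnCount 0 (r ∸ s) (n ∸ i))
    lifted-zero r n i = ≡.sym (begin
      Σ≤ℕ r (λ s → liftedCount 0 s i ℕ.* returnCount 0 (r ∸ s) (n ∸ i))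
        ≡⟨ Σ≤ℕ-cong r (λ s _ → ≡.trans (≡.cong (ℕ._* returnCount 0 (r ∸ s) (n ∸ i)) (liftedCount-zero s i))
                                        (ℕ.*-assoc (χ (0 ≡ᵇ s)) (dyckCount i) _)) ⟩
      Σ≤ℕ r (λ s → χ (0 ≡ᵇ s) ℕ.* (dyckCount i ℕ.* returnCount 0 (r ∸ s) (n ∸ i)))
        ≡⟨ Σ≤ℕ-χ[0≡ᵇ] r (λ s → dyckCount i ℕ.* returnCount 0 (r ∸ s) (n ∸ i)) ⟩
      dyckCount i ℕ.* returnCount 0 r (n ∸ i)
        ≡⟨ ≡.cong (ℕ._* returnCount 0 r (n ∸ i)) (dyckCount≡catalan i) ⟩
      catalan i ℕ.* returnCount 0 r (n ∸ i) ∎)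

module ClosedForm where

  open DefsAsPowerSeries
  open Chebyshev
  open GeneratingFunctions
  open import Defs using (Cat)
  open import Data.Nat using (ℕ; zero; suc)

  private
    module ℤx = CommutativeRing ℤ[[x]].powerSeriesRing
  open ℤ[[x,y]] using (constant; constant-cong; constant-*; constant-sub; geometric; geometric-inverse) renaming (𝐗 to 𝐘)
  open CommutativeRing ℤ[[x,y]].powerSeriesRing
  open CommutativeRingLemmas ℤ[[x,y]].powerSeriesRing
  open IntegerCoefficientSolver ℤ[[x,y]].powerSeriesRing using (solve; _:=_; _:-_)
  open import Relation.Binary.Reasoning.Setoid setoid

  x c : ℤ[[x,y]].Series
  x = constant ℤ[[x]].𝐗
  c = constant Cat

  -- 1 / (denominator k - y x C)
  tail : ℕ → ℤ[[x,y]].Series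
  tail k = geometric (ℤ[[x]].inv (denominator k)) (ℤ[[x]].𝐗 ℤx.* Cat)

  closedForm : ℕ → ℤ[[x,y]].Series
  closedForm k = constant (ratio k) + constant (weight k ℤx.* Cat) * tail k

  tail-inverse : ∀ k → (constant (denominator k) - 𝐘 * (x * c)) * tail k ≈ 1#
  tail-inverse k = trans (*-congʳ (+-congˡ (-‿cong (*-congˡ (sym (constant-* ℤ[[x]].𝐗 Cat))))))
    (geometric-inverse (denominator k) (ℤ[[x]].inv (denominator k)) (ℤ[[x]].𝐗 ℤx.* Cat)
                       (ℤ[[x]].⊛-inv (denominator k) (denominator-constant k)))

  ratio-recurrenceʸ : ∀ k → constant (ratio (suc k)) * (1# - x * constant (ratio k)) ≈ 1#
  ratio-recurrenceʸ k = begin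
    constant r′ * (1# - x * constant (ratio k))                ≈⟨ *-congˡ (+-congˡ (-‿cong (constant-* ℤ[[x]].𝐗 (ratio k)))) ⟨
    constant r′ * (1# - constant (ℤ[[x]].𝐗 ℤx.* ratio k))      ≈⟨ *-congˡ (constant-sub ℤx.1# _) ⟨
    constant r′ * constant (ℤx.1# ℤx.- ℤ[[x]].𝐗 ℤx.* ratio k)  ≈⟨ constant-* r′ _ ⟨
    constant (r′ ℤx.* (ℤx.1# ℤx.- ℤ[[x]].𝐗 ℤx.* ratio k))      ≈⟨ constant-cong (ratio-recurrence k) ⟩
    1#                                                         ∎
    where r′ = ratio (suc k)

  weight-sucʸ : ∀ k → constant (ratio (suc k)) * constant (ratio (suc k)) * x * constant (weight k ℤx.* Cat)
                    ≈ constant (weight (suc k) ℤx.* Cat)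
  weight-sucʸ k = begin
    constant r′ * constant r′ * x * constant (weight k ℤx.* Cat)
      ≈⟨ *-congʳ (*-congʳ (constant-* r′ r′)) ⟨
    constant (r′ ℤx.* r′) * x * constant (weight k ℤx.* Cat)
      ≈⟨ *-congʳ (constant-* (r′ ℤx.* r′) ℤ[[x]].𝐗) ⟨
    constant (r′ ℤx.* r′ ℤx.* ℤ[[x]].𝐗) * constant (weight k ℤx.* Cat)
      ≈⟨ constant-* (r′ ℤx.* r′ ℤx.* ℤ[[x]].𝐗) (weight k ℤx.* Cat) ⟨
    constant (r′ ℤx.* r′ ℤx.* ℤ[[x]].𝐗 ℤx.* (weight k ℤx.* Cat))
      ≈⟨ constant-cong (ℤx.trans (ℤx.sym (ℤx.*-assoc _ (weight k) Cat)) (ℤx.*-congʳ (ℤx.sym (weight-suc k)))) ⟩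
    constant (weight (suc k) ℤx.* Cat) ∎
    where r′ = ratio (suc k)

  denominator-sucʸ : ∀ k → constant (denominator k) - 𝐘 * (x * c) - constant (ratio (suc k)) * x * constant (weight k ℤx.* Cat)
                         ≈ constant (denominator (suc k)) - 𝐘 * (x * c)
  denominator-sucʸ k = begin
    constant (denominator k) - 𝐘 * (x * c) - constant r′ * x * e
      ≈⟨ solve 3 (λ d yz u → d :- yz :- u := d :- u :- yz) refl (constant (denominator k)) (𝐘 * (x * c)) (constant r′ * x * e) ⟩
    constant (denominator k) - constant r′ * x * e - 𝐘 * (x * c)
      ≈⟨ +-congʳ (+-congˡ (-‿cong r′xe≈)) ⟩
    constant (denominator k) - constant (r′ ℤx.* ℤ[[x]].𝐗 ℤx.* weight k ℤx.* Cat) - 𝐘 * (x * c)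
      ≈⟨ +-congʳ (constant-sub _ _) ⟨
    constant (denominator k ℤx.- r′ ℤx.* ℤ[[x]].𝐗 ℤx.* weight k ℤx.* Cat) - 𝐘 * (x * c)
      ≈⟨ +-congʳ (constant-cong (denominator-suc k)) ⟨
    constant (denominator (suc k)) - 𝐘 * (x * c) ∎
    where
    r′ = ratio (suc k)
    e  = constant (weight k ℤx.* Cat)
    r′xe≈ : constant r′ * x * e ≈ constant (r′ ℤx.* ℤ[[x]].𝐗 ℤx.* weight k ℤx.* Cat)
    r′xe≈ = begin
      constant r′ * x * e                                ≈⟨ *-congʳ (constant-* r′ ℤ[[x]].𝐗) ⟨
      constant (r′ ℤx.* ℤ[[x]].𝐗) * e                    ≈⟨ constant-* (r′ ℤx.* ℤ[[x]].𝐗) (weight k ℤx.* Cat) ⟨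
      constant (r′ ℤx.* ℤ[[x]].𝐗 ℤx.* (weight k ℤx.* Cat)) ≈⟨ constant-cong (ℤx.*-assoc (r′ ℤx.* ℤ[[x]].𝐗) (weight k) Cat) ⟨
      constant (r′ ℤx.* ℤ[[x]].𝐗 ℤx.* weight k ℤx.* Cat) ∎

  valleySeries≈closedForm : ∀ k → valleySeries k ≈ closedForm k
  valleySeries≈closedForm zero = begin
    valleySeries 0
      ≈⟨ affine-fixedPoint (valleySeries 0) (x * c) 𝐘 (tail 0) W₀≈ tail₀-inverse ⟩
    1# + (x * c) * tail 0
      ≈⟨ +-cong (constant-cong ratio-zero) (*-congʳ (trans (constant-cong (ℤx.*-congʳ weight-zero)) (constant-* ℤ[[x]].𝐗 Cat))) ⟨
    closedForm 0 ∎
    where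
    W₀≈ : valleySeries 0 ≈ 1# + x * c * (1# + 𝐘 * (valleySeries 0 - 1#))
    W₀≈ = trans valleySeries-zero (+-congˡ (sym (*-assoc x c returnSeries)))
    tail₀-inverse : (1# - 𝐘 * (x * c)) * tail 0 ≈ 1#
    tail₀-inverse = trans (*-congʳ (+-congʳ (constant-cong (ℤx.sym denominator-zero)))) (tail-inverse 0)
  valleySeries≈closedForm (suc k) = inverse-unique {p = 1# - x * valleySeries k}
    (fixedPoint-inverse (valleySeries (suc k)) (x * valleySeries k)
      (trans (valleySeries-suc k) (+-congˡ (sym (*-assoc x (valleySeries k) (valleySeries (suc k)))))))
    (trans (*-congʳ (+-congˡ (*-congʳ (sym (weight-sucʸ k)))))
      (continuedFraction-step (valleySeries k) (constant (ratio k)) (constant (ratio (suc k))) (constant (weight k ℤx.* Cat))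
        (tail k) (tail (suc k)) (constant (denominator k) - 𝐘 * (x * c)) x
        (valleySeries≈closedForm k) (ratio-recurrenceʸ k) (tail-inverse k)
        (trans (*-congʳ (denominator-sucʸ k)) (tail-inverse (suc k)))))

module ClosedFormCoefficients where

  open DefsAsPowerSeries
  open Chebyshev
  open GeneratingFunctions
  open ClosedForm
  open import Defs renaming (inv to inv′)
  open import Data.Nat using (ℕ; zero; suc)

  open CommutativeRing ℤ[[x]].powerSeriesRing
  open ℤ[[x]] using (𝐗; _^_; inv; coeff)
  open IntegerCoefficientSolver ℤ[[x]].powerSeriesRing using (solve; _:=_; _:*_)
  open import Relation.Binary.Reasoning.Setoid setoid

  R≐ratio : ∀ k → R (suc k) ≈ ratio k
  R≐ratio k = trans (⊛≐* (UU k) _) (*-congˡ (inv≐inv (UU (suc k))))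

  invUsq≐weight : ∀ k → invUsq (suc k) ≈ weight k
  invUsq≐weight k = trans (⊛≐* (X ^^ suc k) _)
    (*-cong (trans (^^≐^ X (suc k)) (ℤ[[x]].^-congˡ (suc k) X≐𝐗))
            (trans (inv≐inv _) (ℤ[[x]].inv-cong (⊛≐* (UU (suc k)) (UU (suc k))))))

  denominator≐ : ∀ k → 𝟙 ⊖ X ⊛ (R (suc k) ⊖ 𝟙) ⊛ Cat ≈ denominator k
  denominator≐ k = trans (⊖≐- 𝟙 _) (+-cong 𝟙≐1# (-‿cong
    (trans (⊛≐* (X ⊛ (R (suc k) ⊖ 𝟙)) Cat) (*-congʳ (trans (⊛≐* X _)
      (*-cong X≐𝐗 (trans (⊖≐- (R (suc k)) 𝟙) (+-cong (R≐ratio k) (-‿cong 𝟙≐1#)))))))))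

  constant-coeff : ∀ c r → ℤ[[x,y]].constant c r ≈ δ r 0 * c
  constant-coeff c zero    = sym (trans (*-congʳ 𝟙≐1#) (*-identityˡ c))
  constant-coeff c (suc r) = sym (trans (*-congʳ 𝟘≐0#) (zeroˡ c))

  closedFormCoefficient : ℕ → ℕ → ℤ[[x]].Series
  closedFormCoefficient k r = δ r 0 * ratio k + 𝐗 ^ r * Cat ^ suc r * weight k * inv (denominator k ^ suc r)

  closedForm-coeff : ∀ k r → closedForm k r ≈ closedFormCoefficient k r
  closedForm-coeff k r = begin
    closedForm k r
      ≈⟨ ℤ[[x,y]].⊕-coeff (ℤ[[x,y]].constant (ratio k)) _ r ⟩
    ℤ[[x,y]].constant (ratio k) r + ℤ[[x,y]]._⊛_ (ℤ[[x,y]].constant (weight k * Cat)) (tail k) r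
      ≈⟨ +-cong (constant-coeff (ratio k) r) (ℤ[[x,y]].constant-⊛ (weight k * Cat) (tail k) r) ⟩
    δ r 0 * ratio k + weight k * Cat * ((𝐗 * Cat) ^ r * inv (denominator k) ^ suc r)
      ≈⟨ +-congˡ (*-congˡ (*-cong (ℤ[[x]].^-distrib-* 𝐗 Cat r) (sym (ℤ[[x]].inv-^ (denominator k) (suc r) (denominator-constant k))))) ⟩
    δ r 0 * ratio k + weight k * Cat * (𝐗 ^ r * Cat ^ r * inv (denominator k ^ suc r))
      ≈⟨ +-congˡ (solve 5 (λ w c xʳ cʳ i → w :* c :* (xʳ :* cʳ :* i) := xʳ :* (c :* cʳ) :* w :* i)
                          refl (weight k) Cat (𝐗 ^ r) (Cat ^ r) (inv (denominator k ^ suc r))) ⟩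
    δ r 0 * ratio k + 𝐗 ^ r * Cat ^ suc r * weight k * inv (denominator k ^ suc r) ∎

  rhs≈closedFormCoefficient : ∀ k r →
    δ r 0 ⊛ R (suc k) ⊕ X ^^ r ⊛ Cat ^^ (suc r) ⊛ invUsq (suc k) ⊛ inv′ ((𝟙 ⊖ X ⊛ (R (suc k) ⊖ 𝟙) ⊛ Cat) ^^ (suc r))
      ≈ closedFormCoefficient k r
  rhs≈closedFormCoefficient k r = trans (⊕≐+ _ _) (+-cong (trans (⊛≐* (δ r 0) _) (*-congˡ (R≐ratio k)))
    (trans (⊛≐* _ _) (*-cong
      (trans (⊛≐* _ _) (*-cong (trans (⊛≐* _ _) (*-cong (trans (^^≐^ X r) (ℤ[[x]].^-congˡ r X≐𝐗)) (^^≐^ Cat (suc r))))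
                               (invUsq≐weight k)))
      (trans (inv≐inv _) (ℤ[[x]].inv-cong (trans (^^≐^ _ (suc r)) (ℤ[[x]].^-congˡ (suc r) (denominator≐ k))))))))

open import Defs
open import Data.Nat using (ℕ; suc; _+_)
open ClosedForm using (closedForm; valleySeries≈closedForm)
open ClosedFormCoefficients using (closedFormCoefficient; closedForm-coeff; rhs≈closedFormCoefficient)

mainTheorem2 : ∀ (k r : ℕ) →
    Valley k r ≋
      (δ r 0 ⊛ R (suc k)
       ⊕ X ^^ r ⊛ Cat ^^ (suc r) ⊛ invUsq (suc k)
           ⊛ inv ((𝟙 ⊖ X ⊛ (R (suc k) ⊖ 𝟙) ⊛ Cat) ^^ (suc r)))
mainTheorem2 k r = ℤ[[x]].coeff (begin
  Valley k r                 ≈⟨ ℤ[[x,y]].coeff (valleySeries≈closedForm k) r ⟩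
  closedForm k r             ≈⟨ closedForm-coeff k r ⟩
  closedFormCoefficient k r  ≈⟨ rhs≈closedFormCoefficient k r ⟨
  _                          ∎)
  where open import Relation.Binary.Reasoning.Setoid (CommutativeRing.setoid ℤ[[x]].powerSeriesRing)
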